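{- Let $t,\ell,\lambda$ be integers with $t>\ell\ge0$, $\lambda\ge1$. There exists $M$ such that for $m\ge M$: if $A$ is an $m$-rowed $(0,1)$-matrix with $(\lambda+2)\cdot{\bf 1}_t{\bf 0}_\ell\not\prec A$, with all column sums in $\{t,t+1,\dots,m-\ell\}$ and no repeated column of column sum $t$, then $$\|A\|\le\left(1+\frac{\lambda}{t+1}\right)\binom{m}{t}.$$
   Context: $\|A\|$ is the number of columns counted with multiplicity. ${\bf 1}_t{\bf 0}_\ell$ is the column of $t$ ones above $\ell$ zeros, $q\cdot{\bf v}$ is $q$ copies of ${\bf v}$, and $F\prec A$ means some submatrix of $A$ is a row and column permutation of $F$. -}

module Defs where

open import Data.Nat using (ℕ; zero; suc; _+_; _<ᵇ_)
open import Data.Bool using (Bool; true; false; if_then_else_)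
open import Data.Fin using (Fin; zero; suc; toℕ)
open import Data.Product using (Σ; _×_)
open import Relation.Binary.PropositionalEquality using (_≡_)
open import Relation.Nullary using (¬_)
open import Function.Definitions using (Injective)

-- A (0,1)-matrix with m rows and n columns (columns counted with
-- multiplicity, so ‖A‖ = n).
Matrix : ℕ → ℕ → Set
Matrix m n = Fin m → Fin n → Bool

ones : ∀ {m} → (Fin m → Bool) → ℕ
ones {zero}  v = 0
ones {suc m} v = (if v zero then 1 else 0) + ones (λ i → v (suc i))

colSum : ∀ {m n} → Matrix m n → Fin n → ℕ
colSum A j = ones (λ i → A i j)

_≺_ : ∀ {k p m n} → Matrix k p → Matrix m n → Set
_≺_ {k} {p} {m} {n} F A =
  Σ (Fin k → Fin m) λ r → Σ (Fin p → Fin n) λ c →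
    Injective _≡_ _≡_ r × Injective _≡_ _≡_ c ×
    (∀ i j → A (r i) (c j) ≡ F i j)

copiesOneZero : (q t ℓ : ℕ) → Matrix (t + ℓ) q
copiesOneZero q t ℓ i j = toℕ i <ᵇ t

SameColumn : ∀ {m n} → Matrix m n → Fin n → Fin n → Set
SameColumn A j j' = ∀ i → A i j ≡ A i j'

-- Call a column small if its sum is t or t + 1 and large otherwise. If more than λ' + 1
-- small columns contained a t-set S of rows, λ' + 2 of them would have at most λ' + 2 ones
-- outside S, leaving ℓ rows that are zero in all of them: a copy of (λ' + 2)·1_t0_ℓ. The same
-- argument bounds the small columns containing S together with the large columns containing S
-- and vanishing on an ℓ-set Z of rows free for S. Counting the triples (S, Z, large column)
-- gives  Σ_large weight + C(m−t,ℓ)·Σ_small C(s,t) ≤ (λ'+1)·C(m−t,ℓ)·C(m,t),  where the weight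
-- of a large column counts the pairs (S, Z) it contains. As every column satisfies
-- t + 1 = t·[s = t] + [small]·C(s,t) + [large]·(t + 1) and the columns of sum t are distinct,
-- the theorem follows once each large column has weight at least (t+1)·C(m−t,ℓ). Only there
-- must m be large: a large column with s ones and z zeros has weight at least
-- C(s,t)·C(z−λ'−1,ℓ) and at least C(s,t) − z·(λ'+1)·C(m−1,t−1), and one of the two beats
-- (t+1)·C(m−t,ℓ) whatever the sizes of s and z.

module Submission where

open import Data.Bool using (Bool; true; false; T; not; _∧_; _∨_; if_then_else_)
open import Data.Bool.Properties using (∧-zeroʳ; ∧-identityʳ; ∧-comm)
open import Data.Empty using (⊥; ⊥-elim)
open import Data.Fin using (Fin; zero; suc; toℕ; splitAt; _↑ˡ_; _↑ʳ_)
open import Data.Fin.Properties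
  using (splitAt⁻¹-↑ˡ; splitAt⁻¹-↑ʳ; toℕ-↑ˡ; toℕ-↑ʳ; toℕ<n)
  renaming (suc-injective to Fin-suc-injective)
open import Data.Nat
open import Data.Nat.Properties
open import Data.Nat.Combinatorics using (_C_; nCk+nC[k+1]≡[n+1]C[k+1])
open import Data.Product using (Σ; ∃; _×_; _,_; proj₁; proj₂)
open import Data.Sum using (_⊎_; inj₁; inj₂; [_,_]′)
open import Data.Unit using (tt)
open import Data.Vec.Functional using ([]; _∷_; tail)
open import Function.Definitions using (Injective)
open import Relation.Binary.PropositionalEquality
  using (_≡_; _≢_; refl; sym; trans; cong; cong₂; subst; subst₂; module ≡-Reasoning)
open import Relation.Nullary using (¬_; yes; no)
open import Algebra.Properties.CommutativeSemigroup +-commutativeSemigroup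
  using () renaming (interchange to +-interchange)

open import Defs
open import Data.Nat.Solver using (module +-*-Solver)
open +-*-Solver using (solve; _:=_; con; _:+_; _:*_)

false≢true : false ≢ true
false≢true ()

∧-trueˡ : ∀ {a b} → a ∧ b ≡ true → a ≡ true
∧-trueˡ {true} _ = refl

∧-trueʳ : ∀ {a b} → a ∧ b ≡ true → b ≡ true
∧-trueʳ {true} ab = ab

∧-true : ∀ {a b} → a ≡ true → b ≡ true → a ∧ b ≡ true
∧-true refl refl = refl

∧-falseʳ : ∀ {a b} → a ≡ true → a ∧ b ≡ false → b ≡ false
∧-falseʳ refl ab = ab

not-true : ∀ {a} → not a ≡ true → a ≡ false
not-true {false} _ = refl

∨-true : ∀ {a b} → a ∨ b ≡ true → a ≡ true ⊎ b ≡ true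
∨-true {true}  _  = inj₁ refl
∨-true {false} ab = inj₂ ab

T⇒≡true : ∀ {b} → T b → b ≡ true
T⇒≡true {true} _ = refl

¬T⇒≡false : ∀ {b} → ¬ T b → b ≡ false
¬T⇒≡false {false} _  = refl
¬T⇒≡false {true}  ¬t = ⊥-elim (¬t tt)

≡ᵇ-true⇒≡ : ∀ a b → (a ≡ᵇ b) ≡ true → a ≡ b
≡ᵇ-true⇒≡ a b e = ≡ᵇ⇒≡ a b (subst T (sym e) tt)

Subset : ℕ → Set
Subset m = Fin m → Bool

𝟙 : Bool → ℕ
𝟙 b = if b then 1 else 0

𝟙-mono : ∀ {a b} → (a ≡ true → b ≡ true) → 𝟙 a ≤ 𝟙 b
𝟙-mono {false} a⇒b = z≤n
𝟙-mono {true}  a⇒b rewrite a⇒b refl = ≤-refl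

𝟙-rotate : ∀ a b c → 𝟙 a * 𝟙 (b ∧ c) ≡ 𝟙 b * 𝟙 (c ∧ a)
𝟙-rotate true  true  true  = refl
𝟙-rotate true  true  false = refl
𝟙-rotate true  false c     = refl
𝟙-rotate false true  true  = refl
𝟙-rotate false true  false = refl
𝟙-rotate false false c     = refl

𝟙-shuffle : ∀ a b c d → 𝟙 a * 𝟙 (b ∧ c ∧ d) ≡ 𝟙 (b ∧ d) * 𝟙 (a ∧ c)
𝟙-shuffle false false c     d     = refl
𝟙-shuffle false true  c     false = refl
𝟙-shuffle false true  c     true  = refl
𝟙-shuffle true  false c     d     = refl
𝟙-shuffle true  true  false false = refl
𝟙-shuffle true  true  false true  = refl
𝟙-shuffle true  true  true  false = refl
𝟙-shuffle true  true  true  true  = refl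

sumFin : ∀ {n} → (Fin n → ℕ) → ℕ
sumFin {zero}  f = 0
sumFin {suc n} f = f zero + sumFin (tail f)

sumSub : ∀ {m} → (Subset m → ℕ) → ℕ
sumSub {zero}  f = f []
sumSub {suc m} f = sumSub (λ S → f (false ∷ S)) + sumSub (λ S → f (true ∷ S))

sumFin-cong : ∀ {n} {f g : Fin n → ℕ} → (∀ j → f j ≡ g j) → sumFin f ≡ sumFin g
sumFin-cong {zero}  f≡g = refl
sumFin-cong {suc n} f≡g = cong₂ _+_ (f≡g zero) (sumFin-cong (λ j → f≡g (suc j)))

sumFin-mono : ∀ {n} {f g : Fin n → ℕ} → (∀ j → f j ≤ g j) → sumFin f ≤ sumFin g
sumFin-mono {zero}  f≤g = z≤n
sumFin-mono {suc n} f≤g = +-mono-≤ (f≤g zero) (sumFin-mono (λ j → f≤g (suc j)))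

sumFin-+ : ∀ {n} (f g : Fin n → ℕ) → sumFin (λ j → f j + g j) ≡ sumFin f + sumFin g
sumFin-+ {zero}  f g = refl
sumFin-+ {suc n} f g = trans (cong (f zero + g zero +_) (sumFin-+ (tail f) (tail g)))
  (+-interchange (f zero) (g zero) _ _)

sumFin-*ˡ : ∀ {n} k (f : Fin n → ℕ) → sumFin (λ j → k * f j) ≡ k * sumFin f
sumFin-*ˡ {zero}  k f = sym (*-zeroʳ k)
sumFin-*ˡ {suc n} k f = trans (cong (k * f zero +_) (sumFin-*ˡ k (tail f)))
  (sym (*-distribˡ-+ k (f zero) _))

sumFin-const : ∀ {n} k → sumFin {n} (λ _ → k) ≡ n * k
sumFin-const {zero}  k = refl
sumFin-const {suc n} k = cong (k +_) (sumFin-const {n} k)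

sumSub-cong : ∀ {m} {f g : Subset m → ℕ} → (∀ S → f S ≡ g S) → sumSub f ≡ sumSub g
sumSub-cong {zero}  f≡g = f≡g []
sumSub-cong {suc m} f≡g =
  cong₂ _+_ (sumSub-cong (λ S → f≡g (false ∷ S))) (sumSub-cong (λ S → f≡g (true ∷ S)))

sumSub-mono : ∀ {m} {f g : Subset m → ℕ} → (∀ S → f S ≤ g S) → sumSub f ≤ sumSub g
sumSub-mono {zero}  f≤g = f≤g []
sumSub-mono {suc m} f≤g =
  +-mono-≤ (sumSub-mono (λ S → f≤g (false ∷ S))) (sumSub-mono (λ S → f≤g (true ∷ S)))

sumSub-+ : ∀ {m} (f g : Subset m → ℕ) → sumSub (λ S → f S + g S) ≡ sumSub f + sumSub g
sumSub-+ {zero}  f g = refl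
sumSub-+ {suc m} f g =
  trans (cong₂ _+_ (sumSub-+ (λ S → f (false ∷ S)) (λ S → g (false ∷ S)))
                   (sumSub-+ (λ S → f (true ∷ S)) (λ S → g (true ∷ S))))
        (+-interchange (sumSub (λ S → f (false ∷ S))) _ _ _)

sumSub-*ˡ : ∀ {m} k (f : Subset m → ℕ) → sumSub (λ S → k * f S) ≡ k * sumSub f
sumSub-*ˡ {zero}  k f = refl
sumSub-*ˡ {suc m} k f =
  trans (cong₂ _+_ (sumSub-*ˡ k (λ S → f (false ∷ S))) (sumSub-*ˡ k (λ S → f (true ∷ S))))
        (sym (*-distribˡ-+ k _ _))

sumSub-zero : ∀ {m} → sumSub {m} (λ _ → 0) ≡ 0
sumSub-zero {zero}  = refl
sumSub-zero {suc m} = cong₂ _+_ (sumSub-zero {m}) (sumSub-zero {m})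

sumSub-sumFin-comm : ∀ {m n} (f : Subset m → Fin n → ℕ) →
  sumSub (λ S → sumFin (f S)) ≡ sumFin (λ j → sumSub (λ S → f S j))
sumSub-sumFin-comm {m} {zero}  f = sumSub-zero {m}
sumSub-sumFin-comm {m} {suc n} f =
  trans (sumSub-+ (λ S → f S zero) (λ S → sumFin (tail (f S))))
        (cong (sumSub (λ S → f S zero) +_) (sumSub-sumFin-comm (λ S → tail (f S))))

ones-cong : ∀ {m} {v w : Subset m} → (∀ i → v i ≡ w i) → ones v ≡ ones w
ones-cong {zero}  v≡w = refl
ones-cong {suc m} v≡w = cong₂ _+_ (cong 𝟙 (v≡w zero)) (ones-cong (λ i → v≡w (suc i)))

_⊆_ : ∀ {m} → Subset m → Subset m → Set
S ⊆ W = ∀ i → S i ≡ true → W i ≡ true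

ones-mono : ∀ {m} {v w : Subset m} → v ⊆ w → ones v ≤ ones w
ones-mono {zero}  v⊆w = z≤n
ones-mono {suc m} v⊆w = +-mono-≤ (𝟙-mono (v⊆w zero)) (ones-mono (λ i → v⊆w (suc i)))

ones-false : ∀ {m} → ones {m} (λ _ → false) ≡ 0
ones-false {zero}  = refl
ones-false {suc m} = ones-false {m}

ones-true : ∀ {m} → ones {m} (λ _ → true) ≡ m
ones-true {zero}  = refl
ones-true {suc m} = cong suc (ones-true {m})

ones≡0⇒false : ∀ {m} (v : Subset m) → ones v ≡ 0 → ∀ i → v i ≡ false
ones≡0⇒false v _ zero with v zero
... | false = refl
ones≡0⇒false v eq (suc i) with v zero
... | false = ones≡0⇒false (tail v) eq i

ones≡sumFin : ∀ {m} (v : Subset m) → ones v ≡ sumFin (λ i → 𝟙 (v i))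
ones≡sumFin {zero}  v = refl
ones≡sumFin {suc m} v = cong (𝟙 (v zero) +_) (ones≡sumFin (tail v))

ones-split : ∀ {m} (v w : Subset m) →
  ones v ≡ ones (λ i → v i ∧ w i) + ones (λ i → v i ∧ not (w i))
ones-split {zero}  v w = refl
ones-split {suc m} v w =
  trans (cong₂ _+_ (split (v zero) (w zero)) (ones-split (tail v) (tail w)))
        (+-interchange (𝟙 (v zero ∧ w zero)) _ _ _)
  where
  split : ∀ a b → 𝟙 a ≡ 𝟙 (a ∧ b) + 𝟙 (a ∧ not b)
  split true  true  = refl
  split true  false = refl
  split false b     = refl

ones-complement : ∀ {m} (v : Subset m) → ones v + ones (λ i → not (v i)) ≡ m
ones-complement {zero}  v = refl
ones-complement {suc m} v =
  trans (+-interchange (𝟙 (v zero)) (ones (tail v)) (𝟙 (not (v zero))) _)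
        (cong₂ _+_ (complement (v zero)) (ones-complement (tail v)))
  where
  complement : ∀ a → 𝟙 a + 𝟙 (not a) ≡ 1
  complement true  = refl
  complement false = refl

ones-∨-disjoint : ∀ {m} (v w : Subset m) → (∀ i → v i ∧ w i ≡ false) →
  ones (λ i → v i ∨ w i) ≡ ones v + ones w
ones-∨-disjoint {zero}  v w disj = refl
ones-∨-disjoint {suc m} v w disj =
  trans (cong₂ _+_ (disjoint (v zero) (w zero) (disj zero))
                   (ones-∨-disjoint (tail v) (tail w) (λ i → disj (suc i))))
        (+-interchange (𝟙 (v zero)) (𝟙 (w zero)) _ _)
  where
  disjoint : ∀ a b → a ∧ b ≡ false → 𝟙 (a ∨ b) ≡ 𝟙 a + 𝟙 b
  disjoint true  false _ = refl
  disjoint false b     _ = refl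

ones-∨ : ∀ {m} (v w : Subset m) → ones (λ i → v i ∨ w i) ≤ ones v + ones w
ones-∨ {zero}  v w = z≤n
ones-∨ {suc m} v w =
  subst (𝟙 (v zero ∨ w zero) + ones (λ i → v (suc i) ∨ w (suc i)) ≤_)
        (+-interchange (𝟙 (v zero)) (𝟙 (w zero)) _ _)
        (+-mono-≤ (∨≤ (v zero) (w zero)) (ones-∨ (tail v) (tail w)))
  where
  ∨≤ : ∀ a b → 𝟙 (a ∨ b) ≤ 𝟙 a + 𝟙 b
  ∨≤ true  b = s≤s z≤n
  ∨≤ false b = ≤-refl

ones≤1 : ∀ {n} (v : Subset n) → (∀ j j' → v j ≡ true → v j' ≡ true → j ≡ j') → ones v ≤ 1
ones≤1 {zero}  v unique = z≤n
ones≤1 {suc n} v unique with v zero in v₀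
... | false = ones≤1 (tail v) (λ j j' vj vj' → Fin-suc-injective (unique (suc j) (suc j') vj vj'))
... | true  = ≤-reflexive (cong suc (trans (ones-cong rest-false) (ones-false {n})))
  where
  rest-false : ∀ j → v (suc j) ≡ false
  rest-false j with v (suc j) in vj
  ... | false = refl
  ... | true with unique zero (suc j) v₀ vj
  ... | ()

subset-of-size : ∀ {m} (v : Subset m) k → k ≤ ones v →
  Σ (Subset m) λ w → w ⊆ v × ones w ≡ k
subset-of-size {zero} v zero _ = (λ ()) , (λ ()) , refl
subset-of-size {suc m} v k k≤ with v zero in v₀
subset-of-size {suc m} v zero _ | true = (λ _ → false) , (λ _ ()) , ones-false {suc m}
subset-of-size {suc m} v (suc k) (s≤s k≤) | true with subset-of-size (tail v) k k≤
... | w , w⊆ , |w| = (true ∷ w) , ⊆v , cong suc |w|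
  where
  ⊆v : (true ∷ w) ⊆ v
  ⊆v zero    _ = v₀
  ⊆v (suc i) e = w⊆ i e
subset-of-size {suc m} v k k≤ | false with subset-of-size (tail v) k k≤
... | w , w⊆ , |w| = (false ∷ w) , ⊆v , |w|
  where
  ⊆v : (false ∷ w) ⊆ v
  ⊆v zero    ()
  ⊆v (suc i) e = w⊆ i e

from-Fin0-injective : ∀ {m} {f : Fin 0 → Fin m} → Injective _≡_ _≡_ f
from-Fin0-injective {x = ()}

enumerate : ∀ {m} (v : Subset m) k → k ≤ ones v →
  Σ (Fin k → Fin m) λ f → Injective _≡_ _≡_ f × (∀ i → v (f i) ≡ true)
enumerate {zero} v zero _ = (λ ()) , from-Fin0-injective , (λ ())
enumerate {suc m} v k k≤ with v zero in v₀
enumerate {suc m} v zero _ | true = (λ ()) , from-Fin0-injective , (λ ())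
enumerate {suc m} v (suc k) (s≤s k≤) | true with enumerate (tail v) k k≤
... | g , g-inj , g∈ = f , f-inj , f∈
  where
  f : Fin (suc k) → Fin (suc m)
  f zero    = zero
  f (suc i) = suc (g i)
  f-inj : Injective _≡_ _≡_ f
  f-inj {zero}  {zero}  _  = refl
  f-inj {suc x} {suc y} eq = cong suc (g-inj (Fin-suc-injective eq))
  f∈ : ∀ i → v (f i) ≡ true
  f∈ zero    = v₀
  f∈ (suc i) = g∈ i
enumerate {suc m} v k k≤ | false with enumerate (tail v) k k≤
... | g , g-inj , g∈ = (λ i → suc (g i)) , (λ eq → g-inj (Fin-suc-injective eq)) , g∈

ones-diff : ∀ {m} {S W : Subset m} → S ⊆ W → ones W ≡ ones S + ones (λ i → W i ∧ not (S i))
ones-diff {S = S} {W} S⊆W =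
  trans (ones-split W S) (cong (_+ ones (λ i → W i ∧ not (S i))) (ones-cong W∧S≡S))
  where
  W∧S≡S : ∀ i → W i ∧ S i ≡ S i
  W∧S≡S i with S i in Sᵢ
  ... | true  = cong (_∧ true) (S⊆W i Sᵢ)
  ... | false = ∧-zeroʳ (W i)

⊆∧ones≡⇒≡ : ∀ {m} {S W : Subset m} → S ⊆ W → ones S ≡ ones W → ∀ i → W i ≡ S i
⊆∧ones≡⇒≡ {S = S} {W} S⊆W |S|≡|W| i with S i in Sᵢ
... | true  = S⊆W i Sᵢ
... | false = trans (sym (∧-identityʳ (W i)))
                    (subst (λ b → W i ∧ not b ≡ false) Sᵢ (ones≡0⇒false _ W∖S-empty i))
  where
  W∖S-empty : ones (λ k → W k ∧ not (S k)) ≡ 0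
  W∖S-empty = +-cancelˡ-≡ (ones S) _ 0
    (trans (sym (ones-diff S⊆W)) (trans (sym |S|≡|W|) (sym (+-identityʳ (ones S)))))

any : ∀ {n} → (Fin n → Bool) → Bool
any {zero}  f = false
any {suc n} f = f zero ∨ any (tail f)

any-false : ∀ {n} (f : Fin n → Bool) → any f ≡ false → ∀ j → f j ≡ false
any-false f none zero with f zero
... | false = refl
any-false f none (suc j) with f zero
... | false = any-false (tail f) none j

any-mono : ∀ {n} {f g : Fin n → Bool} → f ⊆ g → any f ≡ true → any g ≡ true
any-mono {suc n} {f} {g} f⊆g some with f zero in f₀
... | true rewrite f⊆g zero f₀ = refl
... | false with g zero
...   | true  = refl
...   | false = any-mono (λ j → f⊆g (suc j)) some

𝟙-any≤ones : ∀ {n} (f : Fin n → Bool) → 𝟙 (any f) ≤ ones f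
𝟙-any≤ones {zero}  f = z≤n
𝟙-any≤ones {suc n} f with f zero
... | true  = s≤s z≤n
... | false = 𝟙-any≤ones (tail f)

ones-any≤sumFin : ∀ {m n} (g : Fin n → Subset m) →
  ones (λ i → any (λ j → g j i)) ≤ sumFin (λ j → ones (g j))
ones-any≤sumFin {m} {zero}  g = ≤-reflexive (ones-false {m})
ones-any≤sumFin {m} {suc n} g =
  ≤-trans (ones-∨ (g zero) (λ i → any (λ j → g (suc j) i)))
          (+-monoʳ-≤ (ones (g zero)) (ones-any≤sumFin (tail g)))

⁅_⁆ : ∀ {m} → Fin m → Subset m
⁅ zero  ⁆ zero    = true
⁅ zero  ⁆ (suc k) = false
⁅ suc i ⁆ zero    = false
⁅ suc i ⁆ (suc k) = ⁅ i ⁆ k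

∈⁅⁆⇒≡ : ∀ {m} {i k : Fin m} → ⁅ i ⁆ k ≡ true → k ≡ i
∈⁅⁆⇒≡ {i = zero}  {zero}  _ = refl
∈⁅⁆⇒≡ {i = suc i} {suc k} e = cong suc (∈⁅⁆⇒≡ e)

ones-⁅⁆ : ∀ {m} (i : Fin m) → ones ⁅ i ⁆ ≡ 1
ones-⁅⁆ {suc m} zero    = cong suc (ones-false {m})
ones-⁅⁆ {suc m} (suc i) = ones-⁅⁆ i

ones-remove : ∀ {m} {W : Subset m} {i} → W i ≡ true →
  ones W ≡ suc (ones (λ k → W k ∧ not (⁅ i ⁆ k)))
ones-remove {W = W} {i} Wᵢ =
  trans (ones-diff ⁅i⁆⊆W) (cong (_+ ones (λ k → W k ∧ not (⁅ i ⁆ k))) (ones-⁅⁆ i))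
  where
  ⁅i⁆⊆W : ⁅ i ⁆ ⊆ W
  ⁅i⁆⊆W k e = subst (λ k → W k ≡ true) (sym (∈⁅⁆⇒≡ e)) Wᵢ

_⊆ᵇ_ : ∀ {m} → Subset m → Subset m → Bool
_⊆ᵇ_ {zero}  S W = true
_⊆ᵇ_ {suc m} S W = (not (S zero) ∨ W zero) ∧ (tail S ⊆ᵇ tail W)

⊆ᵇ-sound : ∀ {m} {S W : Subset m} → S ⊆ᵇ W ≡ true → S ⊆ W
⊆ᵇ-sound {suc m} {S} {W} S⊆W zero Sᵢ with S zero | W zero
... | true | true  = refl
⊆ᵇ-sound {suc m} {S} {W} () zero refl | true | false
⊆ᵇ-sound {suc m} {S} {W} S⊆W (suc i) Sᵢ =
  ⊆ᵇ-sound {m} {tail S} {tail W} (∧-trueʳ {not (S zero) ∨ W zero} S⊆W) i Sᵢ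

⊆ᵇ-complete : ∀ {m} {S W : Subset m} → S ⊆ W → S ⊆ᵇ W ≡ true
⊆ᵇ-complete {zero} S⊆W = refl
⊆ᵇ-complete {suc m} {S} {W} S⊆W with S zero in S₀ | W zero in W₀
... | false | _     = ⊆ᵇ-complete (λ i → S⊆W (suc i))
... | true  | true  = ⊆ᵇ-complete (λ i → S⊆W (suc i))
... | true  | false = ⊥-elim (false≢true (trans (sym W₀) (S⊆W zero S₀)))

⊆ᵇ-∧ : ∀ {m} (S U V : Subset m) → S ⊆ᵇ (λ i → U i ∧ V i) ≡ (S ⊆ᵇ U) ∧ (S ⊆ᵇ V)
⊆ᵇ-∧ {zero}  S U V = refl
⊆ᵇ-∧ {suc m} S U V rewrite ⊆ᵇ-∧ (tail S) (tail U) (tail V) with S zero | U zero | V zero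
... | false | u     | v     = refl
... | true  | true  | true  = refl
... | true  | true  | false = sym (∧-zeroʳ (tail S ⊆ᵇ tail U))
... | true  | false | v     = refl

-- Pascal's rule as the definition, so that binomials reduce by pattern matching.
binom : ℕ → ℕ → ℕ
binom zero    zero    = 1
binom zero    (suc k) = 0
binom (suc n) zero    = 1
binom (suc n) (suc k) = binom n k + binom n (suc k)

binom≡C : ∀ n k → binom n k ≡ n C k
binom≡C zero    zero    = refl
binom≡C zero    (suc k) = refl
binom≡C (suc n) zero    = refl
binom≡C (suc n) (suc k) =
  trans (cong₂ _+_ (binom≡C n k) (binom≡C n (suc k))) (nCk+nC[k+1]≡[n+1]C[k+1] n k)

binom-n-0 : ∀ n → binom n 0 ≡ 1
binom-n-0 zero    = refl
binom-n-0 (suc n) = refl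

binom-n-1 : ∀ n → binom n 1 ≡ n
binom-n-1 zero    = refl
binom-n-1 (suc n) = cong₂ _+_ (binom-n-0 n) (binom-n-1 n)

binom-< : ∀ {n k} → n < k → binom n k ≡ 0
binom-< {zero}  {suc k} _         = refl
binom-< {suc n} {suc k} (s≤s n<k) = cong₂ _+_ (binom-< n<k) (binom-< (m<n⇒m<1+n n<k))

binom-n-n : ∀ n → binom n n ≡ 1
binom-n-n zero    = refl
binom-n-n (suc n) = cong₂ _+_ (binom-n-n n) (binom-< (n<1+n n))

binom-[1+n]-n : ∀ n → binom (suc n) n ≡ suc n
binom-[1+n]-n zero    = refl
binom-[1+n]-n (suc n) = trans (cong₂ _+_ (binom-[1+n]-n n) (binom-n-n (suc n))) (+-comm (suc n) 1)

binom-monoˡ-≤ : ∀ {a b} k → a ≤ b → binom a k ≤ binom b k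
binom-monoˡ-≤ {zero}  {zero}  zero    _         = ≤-refl
binom-monoˡ-≤ {zero}  {suc b} zero    _         = ≤-refl
binom-monoˡ-≤ {zero}          (suc k) _         = z≤n
binom-monoˡ-≤ {suc a} {suc b} zero    _         = ≤-refl
binom-monoˡ-≤ {suc a} {suc b} (suc k) (s≤s a≤b) =
  +-mono-≤ (binom-monoˡ-≤ k a≤b) (binom-monoˡ-≤ (suc k) a≤b)

binom-pos : ∀ {n k} → k ≤ n → 1 ≤ binom n k
binom-pos {n} {k} k≤n = ≤-trans (≤-reflexive (sym (binom-n-n k))) (binom-monoˡ-≤ k k≤n)

binom≤1 : ∀ {n k} → n ≤ k → binom n k ≤ 1
binom≤1 {n} n≤k with m≤n⇒m<n∨m≡n n≤k
... | inj₁ n<k  = ≤-trans (≤-reflexive (binom-< n<k)) z≤n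
... | inj₂ refl = ≤-reflexive (binom-n-n n)

binom-absorb : ∀ n k → suc k * binom (suc n) (suc k) ≡ suc n * binom n k
binom-absorb zero    zero    = refl
binom-absorb zero    (suc k) = *-zeroʳ (suc (suc k))
binom-absorb (suc n) zero    =
  trans (+-identityʳ _) (trans (binom-n-1 (suc (suc n))) (sym (*-identityʳ (suc (suc n)))))
binom-absorb (suc n) (suc k) = begin
    suc (suc k) * (binom (suc n) (suc k) + binom (suc n) (suc (suc k)))
  ≡⟨ *-distribˡ-+ (suc (suc k)) (binom (suc n) (suc k)) _ ⟩
    binom (suc n) (suc k) + suc k * binom (suc n) (suc k) + suc (suc k) * binom (suc n) (suc (suc k))
  ≡⟨ cong₂ (λ x y → binom (suc n) (suc k) + x + y) (binom-absorb n k) (binom-absorb n (suc k)) ⟩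
    binom (suc n) (suc k) + suc n * binom n k + suc n * binom n (suc k)
  ≡⟨ +-assoc (binom (suc n) (suc k)) _ _ ⟩
    binom (suc n) (suc k) + (suc n * binom n k + suc n * binom n (suc k))
  ≡⟨ cong (binom (suc n) (suc k) +_) (sym (*-distribˡ-+ (suc n) (binom n k) _)) ⟩
    binom (suc n) (suc k) + suc n * binom (suc n) (suc k)
  ∎
  where open ≡-Reasoning

countBetween : ∀ {m} → Subset m → Subset m → ℕ → ℕ
countBetween Y W k = sumSub (λ S → 𝟙 ((Y ⊆ᵇ S) ∧ (S ⊆ᵇ W) ∧ (ones S ≡ᵇ k)))

countBetween-binom : ∀ {m} (Y W : Subset m) → Y ⊆ᵇ W ≡ true → ∀ j →
  countBetween Y W (ones Y + j) ≡ binom (ones (λ i → W i ∧ not (Y i))) j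
countBetween-binom {zero} Y W _ zero    = refl
countBetween-binom {zero} Y W _ (suc j) = refl
countBetween-binom {suc m} Y W Y⊆W j with Y zero | W zero
... | true  | false = ⊥-elim (false≢true Y⊆W)
... | false | false =
  trans (cong₂ _+_ (countBetween-binom (tail Y) (tail W) Y⊆W j)
                   (trans (sumSub-cong (λ S → cong 𝟙 (∧-zeroʳ (tail Y ⊆ᵇ S)))) (sumSub-zero {m})))
        (+-identityʳ _)
... | true  | true  =
  trans (cong (_+ countBetween (tail Y) (tail W) (ones (tail Y) + j)) (sumSub-zero {m}))
        (countBetween-binom (tail Y) (tail W) Y⊆W j)
countBetween-binom {suc m} Y W Y⊆W zero | false | true =
  trans (cong₂ _+_ (countBetween-binom (tail Y) (tail W) Y⊆W zero)
                   (trans (sumSub-cong too-large) (sumSub-zero {m})))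
        (trans (+-identityʳ _) (trans (binom-n-0 W∖Y) (sym (binom-n-0 (suc W∖Y)))))
  where
  W∖Y = ones (λ i → tail W i ∧ not (tail Y i))
  suc≢ᵇ : ∀ {a b} → a ≤ b → (suc b ≡ᵇ a) ≡ false
  suc≢ᵇ {zero}  _         = refl
  suc≢ᵇ {suc a} (s≤s a≤b) = suc≢ᵇ a≤b
  too-large : ∀ S → 𝟙 ((tail Y ⊆ᵇ S) ∧ (S ⊆ᵇ tail W) ∧ (suc (ones S) ≡ᵇ ones (tail Y) + 0)) ≡ 0
  too-large S with tail Y ⊆ᵇ S in Y⊆S
  ... | false = refl
  ... | true rewrite +-identityʳ (ones (tail Y))
                   | suc≢ᵇ (ones-mono (⊆ᵇ-sound {m} {tail Y} {S} Y⊆S))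
                   | ∧-zeroʳ (S ⊆ᵇ tail W) = refl
countBetween-binom {suc m} Y W Y⊆W (suc j) | false | true =
  trans (cong₂ _+_ (countBetween-binom (tail Y) (tail W) Y⊆W (suc j))
                   (trans (sumSub-cong shift) (countBetween-binom (tail Y) (tail W) Y⊆W j)))
        (+-comm (binom (ones (λ i → W (suc i) ∧ not (Y (suc i)))) (suc j)) _)
  where
  shift : ∀ S → 𝟙 ((tail Y ⊆ᵇ S) ∧ (S ⊆ᵇ tail W) ∧ (suc (ones S) ≡ᵇ ones (tail Y) + suc j))
              ≡ 𝟙 ((tail Y ⊆ᵇ S) ∧ (S ⊆ᵇ tail W) ∧ (ones S ≡ᵇ ones (tail Y) + j))
  shift S = cong (λ x → 𝟙 ((tail Y ⊆ᵇ S) ∧ (S ⊆ᵇ tail W) ∧ (suc (ones S) ≡ᵇ x)))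
                 (+-suc (ones (tail Y)) j)

∅⊆ᵇ : ∀ {m} (S : Subset m) → (λ _ → false) ⊆ᵇ S ≡ true
∅⊆ᵇ {m} S = ⊆ᵇ-complete {m} {λ _ → false} {S} (λ _ ())

⊆ᵇfull : ∀ {m} (S : Subset m) → S ⊆ᵇ (λ _ → true) ≡ true
⊆ᵇfull {m} S = ⊆ᵇ-complete {m} {S} {λ _ → true} (λ _ _ → refl)

countSubsetsOf : ∀ {m} (W : Subset m) k →
  sumSub (λ S → 𝟙 ((S ⊆ᵇ W) ∧ (ones S ≡ᵇ k))) ≡ binom (ones W) k
countSubsetsOf {m} W k =
  trans (sumSub-cong (λ S → cong (λ b → 𝟙 (b ∧ (S ⊆ᵇ W) ∧ (ones S ≡ᵇ k))) (sym (∅⊆ᵇ S))))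
  (trans (cong (countBetween (λ _ → false) W) (cong (_+ k) (sym (ones-false {m}))))
  (trans (countBetween-binom (λ _ → false) W (∅⊆ᵇ W) k)
         (cong (λ x → binom x k) (ones-cong (λ i → ∧-identityʳ (W i))))))

countSubsets : ∀ {m} k → sumSub {m} (λ S → 𝟙 (ones S ≡ᵇ k)) ≡ binom m k
countSubsets {m} k =
  trans (sumSub-cong {m} (λ S → cong (λ b → 𝟙 (b ∧ (ones S ≡ᵇ k))) (sym (⊆ᵇfull S))))
  (trans (countSubsetsOf {m} (λ _ → true) k) (cong (λ x → binom x k) (ones-true {m})))

ones-⁅⁆+[k∸1] : ∀ {m k} (i : Fin m) → 1 ≤ k → ones ⁅ i ⁆ + (k ∸ 1) ≡ k
ones-⁅⁆+[k∸1] {k = k} i 1≤k = trans (cong (_+ (k ∸ 1)) (ones-⁅⁆ i)) (m+[n∸m]≡n 1≤k)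

countSupersetsOf⁅⁆ : ∀ {m k} (i : Fin m) → 1 ≤ k →
  sumSub (λ S → 𝟙 ((⁅ i ⁆ ⊆ᵇ S) ∧ (ones S ≡ᵇ k))) ≡ binom (m ∸ 1) (k ∸ 1)
countSupersetsOf⁅⁆ {m} {k} i 1≤k =
  trans (sumSub-cong {m} (λ S → cong (λ b → 𝟙 ((⁅ i ⁆ ⊆ᵇ S) ∧ b ∧ (ones S ≡ᵇ k))) (sym (⊆ᵇfull S))))
  (trans (cong (countBetween ⁅ i ⁆ (λ _ → true)) (sym (ones-⁅⁆+[k∸1] i 1≤k)))
  (trans (countBetween-binom ⁅ i ⁆ (λ _ → true) (⊆ᵇfull ⁅ i ⁆) (k ∸ 1))
         (cong (λ n → binom n (k ∸ 1))
               (trans (sym (cong pred (ones-remove {W = λ _ → true} {i} refl))) (cong pred (ones-true {m}))))))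

copiesOneZero-≺ : ∀ {m n} (A : Matrix m n) {t ℓ q} (S Z : Subset m) (K : Subset n) →
  t ≤ ones S → ℓ ≤ ones Z → q ≤ ones K →
  (∀ i → S i ≡ true → Z i ≡ true → ⊥) →
  (∀ j → K j ≡ true → ∀ i → S i ≡ true → A i j ≡ true) →
  (∀ j → K j ≡ true → ∀ i → Z i ≡ true → A i j ≡ false) →
  copiesOneZero q t ℓ ≺ A
copiesOneZero-≺ {m} A {t} {ℓ} {q} S Z K t≤ ℓ≤ q≤ disjoint ones-on zeros-on
  with enumerate S t t≤ | enumerate Z ℓ ℓ≤ | enumerate K q q≤
... | rS , rS-inj , rS∈ | rZ , rZ-inj , rZ∈ | c , c-inj , c∈ = r , c , r-inj , c-inj , entries
  where
  r : Fin (t + ℓ) → Fin m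
  r i = [ rS , rZ ]′ (splitAt t i)

  r-inj : Injective _≡_ _≡_ r
  r-inj {i} {i'} eq with splitAt t i in split | splitAt t i' in split'
  ... | inj₁ a | inj₁ a' =
    trans (sym (splitAt⁻¹-↑ˡ split)) (trans (cong (_↑ˡ ℓ) (rS-inj eq)) (splitAt⁻¹-↑ˡ split'))
  ... | inj₂ b | inj₂ b' =
    trans (sym (splitAt⁻¹-↑ʳ split)) (trans (cong (t ↑ʳ_) (rZ-inj eq)) (splitAt⁻¹-↑ʳ split'))
  ... | inj₁ a | inj₂ b' = ⊥-elim (disjoint (rS a) (rS∈ a) (subst (λ x → Z x ≡ true) (sym eq) (rZ∈ b')))
  ... | inj₂ b | inj₁ a' = ⊥-elim (disjoint (rS a') (rS∈ a') (subst (λ x → Z x ≡ true) eq (rZ∈ b)))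

  entries : ∀ i j → A (r i) (c j) ≡ copiesOneZero q t ℓ i j
  entries i j with splitAt t i in split
  ... | inj₁ a = trans (ones-on (c j) (c∈ j) (rS a) (rS∈ a)) (sym (T⇒≡true (<⇒<ᵇ i<t)))
    where
    i<t : toℕ i < t
    i<t = subst (_< t) (trans (sym (toℕ-↑ˡ a ℓ)) (cong toℕ (splitAt⁻¹-↑ˡ split))) (toℕ<n a)
  ... | inj₂ b = trans (zeros-on (c j) (c∈ j) (rZ b) (rZ∈ b))
                       (sym (¬T⇒≡false (λ i<t → <⇒≱ (<ᵇ⇒< (toℕ i) t i<t) t≤i)))
    where
    t≤i : t ≤ toℕ i
    t≤i = subst (t ≤_) (trans (sym (toℕ-↑ʳ t b)) (cong toℕ (splitAt⁻¹-↑ʳ split))) (m≤m+n t (toℕ b))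

module Avoiding {t ℓ λ' m n : ℕ} (A : Matrix m n)
  (avoids : ¬ (copiesOneZero (λ' + 2) t ℓ ≺ A))
  (room : t + ℓ + (λ' + 2) ≤ m)
  (t≤s : ∀ j → t ≤ colSum A j)
  (distinct : ∀ j j' → colSum A j ≡ t → colSum A j' ≡ t → SameColumn A j j' → j ≡ j') where

  col : Fin n → Subset m
  col j i = A i j

  s : Fin n → ℕ
  s = colSum A

  small : Fin n → Bool
  small j = s j ≤ᵇ suc t

  large : Fin n → Bool
  large j = not (small j)

  smallAbove : Subset m → Subset n
  smallAbove S j = small j ∧ (S ⊆ᵇ col j)

  #smallAbove : Subset m → ℕ
  #smallAbove S = ones (smallAbove S)

  covered : Subset m → Subset m
  covered S i = any (λ j → smallAbove S j ∧ A i j)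

  free : Subset m → Subset m
  free S i = not (S i) ∧ not (covered S i)

  largeThrough : Subset m → Subset m → Subset n
  largeThrough S Z j = large j ∧ (S ⊆ᵇ col j) ∧ (Z ⊆ᵇ (λ i → not (A i j)))

  #largeThrough : Subset m → Subset m → ℕ
  #largeThrough S Z = ones (largeThrough S Z)

  small⇒s≤ : ∀ {j} → small j ≡ true → s j ≤ suc t
  small⇒s≤ {j} e = ≤ᵇ⇒≤ (s j) (suc t) (subst T (sym e) tt)

  small-excess≤1 : ∀ {S j} → ones S ≡ t → smallAbove S j ≡ true →
    ones (λ i → A i j ∧ not (S i)) ≤ 1
  small-excess≤1 {S} {j} |S| above = +-cancelˡ-≤ t _ 1 (begin
    t + ones (λ i → A i j ∧ not (S i))    ≡⟨ cong (_+ _) (sym |S|) ⟩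
    ones S + ones (λ i → A i j ∧ not (S i)) ≡⟨ sym (ones-diff (⊆ᵇ-sound {S = S} {col j} (∧-trueʳ {small j} above))) ⟩
    s j                                     ≤⟨ small⇒s≤ (∧-trueˡ {small j} above) ⟩
    suc t                                   ≡⟨ +-comm 1 t ⟩
    t + 1                                   ∎)
    where open ≤-Reasoning

  excess-union≤ : ∀ {S} → ones S ≡ t → (K : Subset n) → K ⊆ smallAbove S →
    ones (λ i → not (S i) ∧ any (λ j → K j ∧ A i j)) ≤ ones K
  excess-union≤ {S} |S| K K⊆ = begin
    ones (λ i → not (S i) ∧ any (λ j → K j ∧ A i j)) ≤⟨ ones-mono in-union ⟩
    ones (λ i → any (λ j → excess j i))             ≤⟨ ones-any≤sumFin excess ⟩
    sumFin (λ j → ones (excess j))                  ≤⟨ sumFin-mono excess≤ ⟩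
    sumFin (λ j → 𝟙 (K j))                          ≡⟨ sym (ones≡sumFin K) ⟩
    ones K                                          ∎
    where
    open ≤-Reasoning
    excess : Fin n → Subset m
    excess j i = K j ∧ (A i j ∧ not (S i))
    in-union : (λ i → not (S i) ∧ any (λ j → K j ∧ A i j)) ⊆ (λ i → any (λ j → excess j i))
    in-union i e = any-mono (λ j Kj∧Aij → ∧-true (∧-trueˡ {K j} Kj∧Aij)
                                            (∧-true (∧-trueʳ {K j} Kj∧Aij) (∧-trueˡ {not (S i)} e)))
                            (∧-trueʳ {not (S i)} e)
    excess≤ : ∀ j → ones (excess j) ≤ 𝟙 (K j)
    excess≤ j with K j in Kj
    ... | true  = small-excess≤1 |S| (K⊆ j Kj)
    ... | false = ≤-reflexive (ones-false {m})

  #smallAbove≤ : ∀ {S} → ones S ≡ t → #smallAbove S ≤ suc λ'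
  #smallAbove≤ {S} |S| with #smallAbove S ≤? suc λ'
  ... | yes ≤λ+1 = ≤λ+1
  ... | no  >λ+1 = ⊥-elim (avoids (copiesOneZero-≺ A S Z K (≤-reflexive (sym |S|)) ℓ≤|Z|
                                     (≤-reflexive (sym |K|)) disjoint ones-on zeros-on))
    where
    chosen = subset-of-size (smallAbove S) (λ' + 2) (subst (_≤ #smallAbove S) (+-comm 2 λ') (≰⇒> >λ+1))
    K : Subset n
    K = proj₁ chosen
    K⊆ : K ⊆ smallAbove S
    K⊆ = proj₁ (proj₂ chosen)
    |K| : ones K ≡ λ' + 2
    |K| = proj₂ (proj₂ chosen)
    X : Subset m
    X i = any (λ j → K j ∧ A i j)
    Z : Subset m
    Z i = not (S i) ∧ not (X i)
    ℓ≤|Z| : ℓ ≤ ones Z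
    ℓ≤|Z| = +-cancelʳ-≤ (λ' + 2) ℓ (ones Z) (+-cancelˡ-≤ t _ _ (begin
      t + (ℓ + (λ' + 2))                             ≡⟨ sym (+-assoc t ℓ _) ⟩
      t + ℓ + (λ' + 2)                               ≤⟨ room ⟩
      m                                              ≡⟨ sym (ones-complement S) ⟩
      ones S + ones (λ i → not (S i))                ≡⟨ cong₂ _+_ |S| (ones-split (λ i → not (S i)) X) ⟩
      t + (ones (λ i → not (S i) ∧ X i) + ones Z)    ≤⟨ +-monoʳ-≤ t (+-monoˡ-≤ (ones Z) (excess-union≤ |S| K K⊆)) ⟩
      t + (ones K + ones Z)                          ≡⟨ cong (λ k → t + (k + ones Z)) |K| ⟩
      t + ((λ' + 2) + ones Z)                        ≡⟨ cong (t +_) (+-comm (λ' + 2) (ones Z)) ⟩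
      t + (ones Z + (λ' + 2))                        ∎))
      where open ≤-Reasoning
    disjoint : ∀ i → S i ≡ true → Z i ≡ true → ⊥
    disjoint i Sᵢ Zᵢ rewrite Sᵢ = false≢true Zᵢ
    ones-on : ∀ j → K j ≡ true → ∀ i → S i ≡ true → A i j ≡ true
    ones-on j Kj = ⊆ᵇ-sound {S = S} {col j} (∧-trueʳ {small j} (K⊆ j Kj))
    zeros-on : ∀ j → K j ≡ true → ∀ i → Z i ≡ true → A i j ≡ false
    zeros-on j Kj i Zᵢ = ∧-falseʳ Kj (any-false (λ j → K j ∧ A i j) (not-true (∧-trueʳ {not (S i)} Zᵢ)) j)

  #smallAbove+#largeThrough≤ : ∀ {S Z} → ones S ≡ t → ones Z ≡ ℓ → Z ⊆ᵇ free S ≡ true →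
    #smallAbove S + #largeThrough S Z ≤ suc λ'
  #smallAbove+#largeThrough≤ {S} {Z} |S| |Z| Z⊆free
    with #smallAbove S + #largeThrough S Z ≤? suc λ'
  ... | yes ≤λ+1 = ≤λ+1
  ... | no  >λ+1 = ⊥-elim (avoids (copiesOneZero-≺ A S Z K (≤-reflexive (sym |S|)) (≤-reflexive (sym |Z|))
                                     λ'+2≤|K| disjoint ones-on zeros-on))
    where
    K : Subset n
    K j = smallAbove S j ∨ largeThrough S Z j
    small∧large : ∀ j → smallAbove S j ∧ largeThrough S Z j ≡ false
    small∧large j with small j
    ... | true  = ∧-zeroʳ (S ⊆ᵇ col j)
    ... | false = refl
    λ'+2≤|K| : λ' + 2 ≤ ones K
    λ'+2≤|K| = subst₂ _≤_ (+-comm 2 λ') (sym (ones-∨-disjoint (smallAbove S) (largeThrough S Z) small∧large))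
                      (≰⇒> >λ+1)
    Z⊆free′ : Z ⊆ free S
    Z⊆free′ = ⊆ᵇ-sound {S = Z} {free S} Z⊆free
    disjoint : ∀ i → S i ≡ true → Z i ≡ true → ⊥
    disjoint i Sᵢ Zᵢ with Z⊆free′ i Zᵢ
    ... | freeᵢ rewrite Sᵢ = false≢true freeᵢ
    ones-on : ∀ j → K j ≡ true → ∀ i → S i ≡ true → A i j ≡ true
    ones-on j Kj with ∨-true {smallAbove S j} Kj
    ... | inj₁ sm = ⊆ᵇ-sound {S = S} {col j} (∧-trueʳ {small j} sm)
    ... | inj₂ lg = ⊆ᵇ-sound {S = S} {col j} (∧-trueˡ {S ⊆ᵇ col j} (∧-trueʳ {large j} lg))
    zeros-on : ∀ j → K j ≡ true → ∀ i → Z i ≡ true → A i j ≡ false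
    zeros-on j Kj i Zᵢ with ∨-true {smallAbove S j} Kj
    ... | inj₁ sm = ∧-falseʳ sm (any-false (λ j → smallAbove S j ∧ A i j)
                                   (not-true (∧-trueʳ {not (S i)} (Z⊆free′ i Zᵢ))) j)
    ... | inj₂ lg = not-true (⊆ᵇ-sound {S = Z} {λ i → not (A i j)} (∧-trueʳ {S ⊆ᵇ col j} (∧-trueʳ {large j} lg)) i Zᵢ)

  tSet : Subset m → Bool
  tSet S = ones S ≡ᵇ t

  #zeroSets : ℕ
  #zeroSets = binom (m ∸ t) ℓ

  freeOff : Subset m → Fin n → Subset m
  freeOff S j i = free S i ∧ not (A i j)

  coveredOff : Subset m → Fin n → Subset m
  coveredOff S j i = not (A i j) ∧ covered S i

  weight : Fin n → ℕ
  weight j = sumSub (λ S → 𝟙 ((S ⊆ᵇ col j) ∧ tSet S) * binom (ones (freeOff S j)) ℓ)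

  admissible : Subset m → Subset m → ℕ
  admissible S Z = 𝟙 ((Z ⊆ᵇ free S) ∧ (ones Z ≡ᵇ ℓ))

  incidence : Subset m → Subset m → Fin n → ℕ
  incidence S Z j = 𝟙 (tSet S) * (admissible S Z * 𝟙 (largeThrough S Z j))

  no-incidences : ∀ b S → sumSub (λ Z → 𝟙 b * (admissible S Z * 0)) ≡ 0
  no-incidences b S =
    trans (sumSub-cong {m} (λ Z → trans (cong (𝟙 b *_) (*-zeroʳ (admissible S Z))) (*-zeroʳ (𝟙 b))))
          (sumSub-zero {m})

  incidences-of-column : ∀ S j →
    sumSub (λ Z → incidence S Z j)
      ≡ 𝟙 (large j) * (𝟙 ((S ⊆ᵇ col j) ∧ tSet S) * binom (ones (freeOff S j)) ℓ)
  incidences-of-column S j with large j | S ⊆ᵇ col j | tSet S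
  ... | false | _     | b     = no-incidences b S
  ... | true  | false | b     = no-incidences b S
  ... | true  | true  | false = sumSub-zero {m}
  ... | true  | true  | true  =
    trans (sumSub-cong both)
          (trans (countSubsetsOf (freeOff S j) ℓ) (sym (trans (+-identityʳ _) (+-identityʳ _))))
    where
    both : ∀ Z → admissible S Z * 𝟙 (Z ⊆ᵇ (λ i → not (A i j))) + 0
               ≡ 𝟙 ((Z ⊆ᵇ freeOff S j) ∧ (ones Z ≡ᵇ ℓ))
    both Z rewrite ⊆ᵇ-∧ Z (free S) (λ i → not (A i j))
      with Z ⊆ᵇ free S | Z ⊆ᵇ (λ i → not (A i j)) | ones Z ≡ᵇ ℓ
    ... | false | _     | _     = refl
    ... | true  | false | false = refl
    ... | true  | false | true  = refl
    ... | true  | true  | false = refl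
    ... | true  | true  | true  = refl

  incidences≡weights :
    sumSub (λ S → sumSub (λ Z → sumFin (incidence S Z))) ≡ sumFin (λ j → 𝟙 (large j) * weight j)
  incidences≡weights =
    trans (sumSub-cong {m} (λ S → sumSub-sumFin-comm (incidence S)))
    (trans (sumSub-sumFin-comm (λ S j → sumSub (λ Z → incidence S Z j)))
           (sumFin-cong (λ j → trans (sumSub-cong {m} (λ S → incidences-of-column S j))
                                     (sumSub-*ˡ {m} (𝟙 (large j)) _))))

  |free|≤ : ∀ {S} → ones S ≡ t → ones (free S) ≤ m ∸ t
  |free|≤ {S} |S| = begin
    ones (free S)                              ≤⟨ ones-mono (λ i e → ∧-trueˡ {not (S i)} e) ⟩
    ones (λ i → not (S i))                     ≡⟨ sym (m+n∸m≡n (ones S) _) ⟩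
    ones S + ones (λ i → not (S i)) ∸ ones S   ≡⟨ cong₂ _∸_ (ones-complement S) |S| ⟩
    m ∸ t                                      ∎
    where open ≤-Reasoning

  incidences-through : ∀ S → sumSub (λ Z → sumFin (incidence S Z))
                             ≡ 𝟙 (tSet S) * sumSub (λ Z → admissible S Z * #largeThrough S Z)
  incidences-through S = trans (sumSub-cong {m} through) (sumSub-*ˡ {m} (𝟙 (tSet S)) _)
    where
    through : ∀ Z → sumFin (incidence S Z) ≡ 𝟙 (tSet S) * (admissible S Z * #largeThrough S Z)
    through Z = trans (sumFin-*ˡ {n} (𝟙 (tSet S)) _)
                (cong (𝟙 (tSet S) *_) (trans (sumFin-*ˡ (admissible S Z) (λ j → 𝟙 (largeThrough S Z j)))
                                            (cong (admissible S Z *_) (sym (ones≡sumFin (largeThrough S Z))))))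

  largeIncidences≤ : ∀ {S} → ones S ≡ t →
    sumSub (λ Z → admissible S Z * #largeThrough S Z) ≤ (suc λ' ∸ #smallAbove S) * #zeroSets
  largeIncidences≤ {S} |S| = begin
      sumSub (λ Z → admissible S Z * #largeThrough S Z)
    ≤⟨ sumSub-mono {m} bounded ⟩
      sumSub (λ Z → admissible S Z * spare)
    ≡⟨ trans (sumSub-cong {m} (λ Z → *-comm (admissible S Z) spare)) (sumSub-*ˡ spare (admissible S)) ⟩
      spare * sumSub (admissible S)
    ≡⟨ cong (spare *_) (countSubsetsOf (free S) ℓ) ⟩
      spare * binom (ones (free S)) ℓ
    ≤⟨ *-monoʳ-≤ spare (binom-monoˡ-≤ ℓ (|free|≤ |S|)) ⟩
      spare * #zeroSets
    ∎
    where
    open ≤-Reasoning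
    spare : ℕ
    spare = suc λ' ∸ #smallAbove S
    bounded : ∀ Z → admissible S Z * #largeThrough S Z ≤ admissible S Z * spare
    bounded Z with Z ⊆ᵇ free S in Z⊆free | ones Z ≡ᵇ ℓ in |Z|
    ... | false | _     = z≤n
    ... | true  | false = z≤n
    ... | true  | true  = +-monoˡ-≤ 0 (m+n≤o⇒m≤o∸n _ (subst (_≤ suc λ') (+-comm (#smallAbove S) _)
                            (#smallAbove+#largeThrough≤ |S| (≡ᵇ-true⇒≡ (ones Z) ℓ |Z|) Z⊆free)))

  incidences+small≤ : ∀ S →
    sumSub (λ Z → sumFin (incidence S Z)) + #zeroSets * (𝟙 (tSet S) * #smallAbove S)
      ≤ #zeroSets * (suc λ' * 𝟙 (tSet S))
  incidences+small≤ S rewrite incidences-through S with tSet S in tS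
  ... | false = subst (_≤ #zeroSets * (suc λ' * 0)) (sym (*-zeroʳ #zeroSets)) z≤n
  ... | true  = begin
      sumSub (λ Z → admissible S Z * #largeThrough S Z) + 0 + #zeroSets * (#smallAbove S + 0)
    ≡⟨ cong₂ _+_ (+-identityʳ _) (cong (#zeroSets *_) (+-identityʳ _)) ⟩
      sumSub (λ Z → admissible S Z * #largeThrough S Z) + #zeroSets * #smallAbove S
    ≤⟨ +-monoˡ-≤ _ (largeIncidences≤ |S|) ⟩
      (suc λ' ∸ #smallAbove S) * #zeroSets + #zeroSets * #smallAbove S
    ≡⟨ trans (cong (_+ #zeroSets * #smallAbove S) (*-comm _ #zeroSets))
             (sym (*-distribˡ-+ #zeroSets (suc λ' ∸ #smallAbove S) (#smallAbove S))) ⟩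
      #zeroSets * (suc λ' ∸ #smallAbove S + #smallAbove S)
    ≡⟨ cong (#zeroSets *_) (trans (m∸n+n≡m (#smallAbove≤ |S|)) (sym (*-identityʳ (suc λ')))) ⟩
      #zeroSets * (suc λ' * 1)
    ∎
    where
    open ≤-Reasoning
    |S| : ones S ≡ t
    |S| = ≡ᵇ-true⇒≡ (ones S) t tS

  tSets≡smallBinoms : sumSub (λ S → 𝟙 (tSet S) * #smallAbove S) ≡ sumFin (λ j → 𝟙 (small j) * binom (s j) t)
  tSets≡smallBinoms =
    trans (sumSub-cong {m} (λ S → trans (cong (𝟙 (tSet S) *_) (ones≡sumFin (smallAbove S)))
                                        (sym (sumFin-*ˡ (𝟙 (tSet S)) (λ j → 𝟙 (smallAbove S j))))))
    (trans (sumSub-sumFin-comm (λ S j → 𝟙 (tSet S) * 𝟙 (smallAbove S j)))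
           (sumFin-cong (λ j → trans (sumSub-cong {m} (λ S → 𝟙-rotate (tSet S) (small j) (S ⊆ᵇ col j)))
                               (trans (sumSub-*ˡ (𝟙 (small j)) (λ S → 𝟙 ((S ⊆ᵇ col j) ∧ tSet S)))
                                      (cong (𝟙 (small j) *_) (countSubsetsOf (col j) t))))))

  double-count : sumFin (λ j → 𝟙 (large j) * weight j) + #zeroSets * sumFin (λ j → 𝟙 (small j) * binom (s j) t)
                   ≤ #zeroSets * (suc λ' * binom m t)
  double-count = begin
      sumFin (λ j → 𝟙 (large j) * weight j) + #zeroSets * sumFin (λ j → 𝟙 (small j) * binom (s j) t)
    ≡⟨ cong₂ _+_ (sym incidences≡weights) (cong (#zeroSets *_) (sym tSets≡smallBinoms)) ⟩
      sumSub (λ S → sumSub (λ Z → sumFin (incidence S Z)))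
        + #zeroSets * sumSub (λ S → 𝟙 (tSet S) * #smallAbove S)
    ≡⟨ cong (sumSub (λ S → sumSub (λ Z → sumFin (incidence S Z))) +_) (sym (sumSub-*ˡ {m} #zeroSets _)) ⟩
      sumSub (λ S → sumSub (λ Z → sumFin (incidence S Z)))
        + sumSub (λ S → #zeroSets * (𝟙 (tSet S) * #smallAbove S))
    ≡⟨ sym (sumSub-+ {m} _ _) ⟩
      sumSub (λ S → sumSub (λ Z → sumFin (incidence S Z)) + #zeroSets * (𝟙 (tSet S) * #smallAbove S))
    ≤⟨ sumSub-mono {m} incidences+small≤ ⟩
      sumSub (λ S → #zeroSets * (suc λ' * 𝟙 (tSet S)))
    ≡⟨ sumSub-*ˡ {m} #zeroSets _ ⟩
      #zeroSets * sumSub (λ S → suc λ' * 𝟙 (tSet S))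
    ≡⟨ cong (#zeroSets *_) (trans (sumSub-*ˡ {m} (suc λ') _) (cong (suc λ' *_) (countSubsets {m} t))) ⟩
      #zeroSets * (suc λ' * binom m t)
    ∎
    where open ≤-Reasoning

  tColumnsAbove : Subset m → Subset n
  tColumnsAbove S j = (s j ≡ᵇ t) ∧ (S ⊆ᵇ col j)

  tColumnsAbove≤1 : ∀ {S} → ones S ≡ t → ones (tColumnsAbove S) ≤ 1
  tColumnsAbove≤1 {S} |S| = ones≤1 (tColumnsAbove S) λ j j' above above' →
    distinct j j' (|col| above) (|col| above') (λ i → trans (col≡S above i) (sym (col≡S above' i)))
    where
    |col| : ∀ {j} → tColumnsAbove S j ≡ true → s j ≡ t
    |col| {j} above = ≡ᵇ-true⇒≡ (s j) t (∧-trueˡ {s j ≡ᵇ t} above)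
    col≡S : ∀ {j} → tColumnsAbove S j ≡ true → ∀ i → A i j ≡ S i
    col≡S {j} above = ⊆∧ones≡⇒≡ (⊆ᵇ-sound {S = S} {col j} (∧-trueʳ {s j ≡ᵇ t} above))
                                (trans |S| (sym (|col| above)))

  #tColumns≤ : sumFin (λ j → 𝟙 (s j ≡ᵇ t)) ≤ binom m t
  #tColumns≤ = begin
      sumFin (λ j → 𝟙 (s j ≡ᵇ t))
    ≡⟨ sumFin-cong (λ j → trans (times-binom j) (cong (𝟙 (s j ≡ᵇ t) *_) (sym (countSubsetsOf (col j) t)))) ⟩
      sumFin (λ j → 𝟙 (s j ≡ᵇ t) * sumSub (λ S → 𝟙 ((S ⊆ᵇ col j) ∧ tSet S)))
    ≡⟨ sumFin-cong (λ j → sym (sumSub-*ˡ {m} (𝟙 (s j ≡ᵇ t)) _)) ⟩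
      sumFin (λ j → sumSub (λ S → 𝟙 (s j ≡ᵇ t) * 𝟙 ((S ⊆ᵇ col j) ∧ tSet S)))
    ≡⟨ sym (sumSub-sumFin-comm (λ S j → 𝟙 (s j ≡ᵇ t) * 𝟙 ((S ⊆ᵇ col j) ∧ tSet S))) ⟩
      sumSub (λ S → sumFin (λ j → 𝟙 (s j ≡ᵇ t) * 𝟙 ((S ⊆ᵇ col j) ∧ tSet S)))
    ≡⟨ sumSub-cong {m} (λ S → sumFin-cong (λ j → rotate² (s j ≡ᵇ t) (S ⊆ᵇ col j) (tSet S))) ⟩
      sumSub (λ S → sumFin (λ j → 𝟙 (tSet S) * 𝟙 (tColumnsAbove S j)))
    ≡⟨ sumSub-cong {m} (λ S → trans (sumFin-*ˡ {n} (𝟙 (tSet S)) _)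
                                    (cong (𝟙 (tSet S) *_) (sym (ones≡sumFin (tColumnsAbove S))))) ⟩
      sumSub (λ S → 𝟙 (tSet S) * ones (tColumnsAbove S))
    ≤⟨ sumSub-mono {m} at-most-one ⟩
      sumSub (λ S → 𝟙 (tSet S))
    ≡⟨ countSubsets {m} t ⟩
      binom m t
    ∎
    where
    open ≤-Reasoning
    times-binom : ∀ j → 𝟙 (s j ≡ᵇ t) ≡ 𝟙 (s j ≡ᵇ t) * binom (s j) t
    times-binom j with s j ≡ᵇ t in |col|
    ... | false = refl
    ... | true  = sym (trans (+-identityʳ _) (trans (cong (λ k → binom k t) (≡ᵇ-true⇒≡ (s j) t |col|)) (binom-n-n t)))
    rotate² : ∀ a b c → 𝟙 a * 𝟙 (b ∧ c) ≡ 𝟙 c * 𝟙 (a ∧ b)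
    rotate² a b c = trans (𝟙-rotate a b c) (𝟙-rotate b c a)
    at-most-one : ∀ S → 𝟙 (tSet S) * ones (tColumnsAbove S) ≤ 𝟙 (tSet S)
    at-most-one S with tSet S in tS
    ... | false = ≤-refl
    ... | true  = +-monoˡ-≤ 0 (tColumnsAbove≤1 (≡ᵇ-true⇒≡ (ones S) t tS))

  column-share : ∀ j → t + 1 ≡ t * 𝟙 (s j ≡ᵇ t) + (𝟙 (small j) * binom (s j) t + 𝟙 (large j) * (t + 1))
  column-share j with s j ≡ᵇ t in |col|≡t | small j in sm
  ... | true  | true  = cong₂ _+_ (sym (*-identityʳ t))
                          (sym (trans (+-identityʳ _) (trans (+-identityʳ _)
                                 (trans (cong (λ k → binom k t) (≡ᵇ-true⇒≡ (s j) t |col|≡t)) (binom-n-n t)))))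
  ... | true  | false = ⊥-elim (false≢true (trans (sym sm) (T⇒≡true (≤⇒≤ᵇ s≤1+t))))
    where
    s≤1+t : s j ≤ suc t
    s≤1+t = ≤-trans (≤-reflexive (≡ᵇ-true⇒≡ (s j) t |col|≡t)) (n≤1+n t)
  ... | false | true  rewrite *-zeroʳ t =
    trans (+-comm t 1) (sym (trans (+-identityʳ _) (trans (+-identityʳ _)
          (trans (cong (λ k → binom k t) |col|≡t+1) (binom-[1+n]-n t)))))
    where
    |col|≡t+1 : s j ≡ suc t
    |col|≡t+1 = ≤-antisym (small⇒s≤ sm) (≤∧≢⇒< (t≤s j) t≢s)
      where
      t≢s : t ≢ s j
      t≢s t≡s = false≢true (trans (sym |col|≡t) (T⇒≡true (≡⇒≡ᵇ (s j) t (sym t≡s))))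
  ... | false | false rewrite *-zeroʳ t = sym (+-identityʳ (t + 1))

  #zeroSets-pos : 1 ≤ #zeroSets
  #zeroSets-pos = binom-pos (m+n≤o⇒m≤o∸n ℓ (≤-trans (≤-reflexive (+-comm ℓ t)) (m+n≤o⇒m≤o (t + ℓ) room)))

  bound-from-weights : (∀ j → large j ≡ true → (t + 1) * #zeroSets ≤ weight j) →
    (t + 1) * n ≤ (t + 1 + λ') * (m C t)
  bound-from-weights heavy = begin
      (t + 1) * n
    ≡⟨ trans (*-comm (t + 1) n) (sym (sumFin-const {n} (t + 1))) ⟩
      sumFin {n} (λ _ → t + 1)
    ≡⟨ sumFin-cong {n} column-share ⟩
      sumFin (λ j → t * 𝟙 (s j ≡ᵇ t) + (smallPart j + largePart j))
    ≡⟨ trans (sumFin-+ {n} _ _) (cong₂ _+_ (sumFin-*ˡ {n} t _) (sumFin-+ smallPart largePart)) ⟩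
      t * sumFin (λ j → 𝟙 (s j ≡ᵇ t)) + (sumFin smallPart + sumFin largePart)
    ≤⟨ +-mono-≤ (*-monoʳ-≤ t #tColumns≤) small+large≤ ⟩
      t * binom m t + suc λ' * binom m t
    ≡⟨ sym (*-distribʳ-+ (binom m t) t (suc λ')) ⟩
      (t + suc λ') * binom m t
    ≡⟨ cong₂ _*_ (sym (+-assoc t 1 λ')) (binom≡C m t) ⟩
      (t + 1 + λ') * (m C t)
    ∎
    where
    open ≤-Reasoning
    smallPart largePart : Fin n → ℕ
    smallPart j = 𝟙 (small j) * binom (s j) t
    largePart j = 𝟙 (large j) * (t + 1)
    instance
      #zeroSets≢0 : NonZero #zeroSets
      #zeroSets≢0 = >-nonZero #zeroSets-pos
    scaled-large≤ : ∀ j → #zeroSets * largePart j ≤ 𝟙 (large j) * weight j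
    scaled-large≤ j with large j in lg
    ... | false = ≤-reflexive (*-zeroʳ #zeroSets)
    ... | true  = ≤-trans (≤-reflexive (trans (cong (#zeroSets *_) (+-identityʳ (t + 1)))
                                             (trans (*-comm #zeroSets (t + 1)) (sym (+-identityʳ _)))))
                          (+-monoˡ-≤ 0 (heavy j lg))
    small+large≤ : sumFin smallPart + sumFin largePart ≤ suc λ' * binom m t
    small+large≤ = *-cancelˡ-≤ #zeroSets (begin
        #zeroSets * (sumFin smallPart + sumFin largePart)
      ≡⟨ trans (*-distribˡ-+ #zeroSets _ _) (+-comm (#zeroSets * sumFin smallPart) _) ⟩
        #zeroSets * sumFin largePart + #zeroSets * sumFin smallPart
      ≤⟨ +-monoˡ-≤ _ (≤-trans (≤-reflexive (sym (sumFin-*ˡ #zeroSets largePart))) (sumFin-mono scaled-large≤)) ⟩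
        sumFin (λ j → 𝟙 (large j) * weight j) + #zeroSets * sumFin smallPart
      ≤⟨ double-count ⟩
        #zeroSets * (suc λ' * binom m t)
      ∎)

  zeros : Fin n → ℕ
  zeros j = ones (λ i → not (A i j))

  large⇒2+t≤s : ∀ {j} → large j ≡ true → suc (suc t) ≤ s j
  large⇒2+t≤s {j} lg = ≰⇒> (λ s≤1+t → false≢true (trans (sym (not-true lg)) (T⇒≡true (≤⇒≤ᵇ s≤1+t))))

  ℓ≤zeros : ∀ {j} → s j ≤ m ∸ ℓ → ℓ ≤ zeros j
  ℓ≤zeros {j} s≤m∸ℓ = +-cancelˡ-≤ (s j) ℓ (zeros j) (begin
    s j + ℓ        ≤⟨ +-monoˡ-≤ ℓ s≤m∸ℓ ⟩
    m ∸ ℓ + ℓ      ≡⟨ m∸n+n≡m (m+n≤o⇒n≤o t (m+n≤o⇒m≤o (t + ℓ) room)) ⟩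
    m              ≡⟨ sym (ones-complement (col j)) ⟩
    s j + zeros j  ∎)
    where open ≤-Reasoning

  tSubsetOf : Subset m → Fin n → Bool
  tSubsetOf S j = (S ⊆ᵇ col j) ∧ tSet S

  |tSubsetOf| : ∀ {S j} → tSubsetOf S j ≡ true → ones S ≡ t
  |tSubsetOf| {S} {j} e = ≡ᵇ-true⇒≡ (ones S) t (∧-trueʳ {S ⊆ᵇ col j} e)

  ⊆col : ∀ {S j} → tSubsetOf S j ≡ true → S ⊆ col j
  ⊆col {S} {j} e = ⊆ᵇ-sound {S = S} {col j} (∧-trueˡ {S ⊆ᵇ col j} e)

  zeros≤free+covered : ∀ {S j} → tSubsetOf S j ≡ true →
    zeros j ≤ ones (freeOff S j) + ones (coveredOff S j)
  zeros≤free+covered {S} {j} e =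
    ≤-trans (≤-reflexive (ones-split (λ i → not (A i j)) (free S)))
            (+-mono-≤ (≤-reflexive (ones-cong (λ i → ∧-comm (not (A i j)) (free S i)))) (ones-mono unfree))
    where
    unfree : (λ i → not (A i j) ∧ not (free S i)) ⊆ coveredOff S j
    unfree i x with A i j in Aᵢ | S i in Sᵢ | covered S i
    ... | false | false | true  = refl
    ... | false | true  | _     = ⊥-elim (false≢true (trans (sym Aᵢ) (⊆col e i Sᵢ)))
    ... | false | false | false = ⊥-elim (false≢true x)

  covered-zeros≤ : ∀ {S j} → tSubsetOf S j ≡ true → ones (coveredOff S j) ≤ suc λ'
  covered-zeros≤ {S} {j} e = begin
    ones (coveredOff S j) ≤⟨ ones-mono outside-S ⟩
    ones (λ i → not (S i) ∧ covered S i)   ≤⟨ excess-union≤ (|tSubsetOf| e) (smallAbove S) (λ _ above → above) ⟩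
    #smallAbove S                          ≤⟨ #smallAbove≤ (|tSubsetOf| e) ⟩
    suc λ'                                 ∎
    where
    open ≤-Reasoning
    outside-S : coveredOff S j ⊆ (λ i → not (S i) ∧ covered S i)
    outside-S i x with A i j in Aᵢ | S i in Sᵢ
    ... | false | false = x
    ... | false | true  = ⊥-elim (false≢true (trans (sym Aᵢ) (⊆col e i Sᵢ)))

  weight≥ : ∀ j → binom (s j) t * binom (zeros j ∸ suc λ') ℓ ≤ weight j
  weight≥ j = begin
      binom (s j) t * c
    ≡⟨ sym (trans (sumSub-cong {m} (λ S → *-comm (𝟙 (tSubsetOf S j)) c))
              (trans (sumSub-*ˡ {m} c (λ S → 𝟙 (tSubsetOf S j)))
              (trans (cong (c *_) (countSubsetsOf (col j) t)) (*-comm c (binom (s j) t))))) ⟩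
      sumSub (λ S → 𝟙 (tSubsetOf S j) * c)
    ≤⟨ sumSub-mono {m} each ⟩
      weight j
    ∎
    where
    open ≤-Reasoning
    c = binom (zeros j ∸ suc λ') ℓ
    each : ∀ S → 𝟙 (tSubsetOf S j) * c ≤ 𝟙 (tSubsetOf S j) * binom (ones (freeOff S j)) ℓ
    each S with tSubsetOf S j in e
    ... | false = z≤n
    ... | true  = +-monoˡ-≤ 0 (binom-monoˡ-≤ ℓ (subst (zeros j ∸ suc λ' ≤_) (m+n∸n≡m freeZeros (suc λ'))
                    (∸-monoˡ-≤ (suc λ') (≤-trans (zeros≤free+covered e) (+-monoʳ-≤ freeZeros (covered-zeros≤ e))))))
      where
      freeZeros = ones (freeOff S j)

  overcount : Fin n → ℕ
  overcount j = sumSub (λ S → 𝟙 (tSubsetOf S j) * ones (coveredOff S j))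

  binom≤weight+overcount : ∀ j → ℓ ≤ zeros j → binom (s j) t ≤ weight j + overcount j
  binom≤weight+overcount j ℓ≤zeros = begin
    binom (s j) t                                  ≡⟨ sym (countSubsetsOf (col j) t) ⟩
    sumSub (λ S → 𝟙 (tSubsetOf S j))               ≤⟨ ≤-trans (sumSub-mono {m} each) (≤-reflexive (sumSub-+ {m} _ _)) ⟩
    weight j + overcount j                         ∎
    where
    open ≤-Reasoning
    each : ∀ S → 𝟙 (tSubsetOf S j)
      ≤ 𝟙 (tSubsetOf S j) * binom (ones (freeOff S j)) ℓ
        + 𝟙 (tSubsetOf S j) * ones (coveredOff S j)
    each S with tSubsetOf S j in e
    ... | false = z≤n
    ... | true with ones (coveredOff S j) | zeros≤free+covered e
    ...   | zero  | zeros≤ = ≤-trans (binom-pos (≤-trans ℓ≤zeros (≤-trans zeros≤ (≤-reflexive (+-identityʳ _)))))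
                                     (≤-reflexive (sym (trans (+-identityʳ _) (+-identityʳ _))))
    ...   | suc _ | _      = ≤-trans (s≤s z≤n) (m≤n+m _ _)

  colWithout : Fin n → Fin m → Subset m
  colWithout j' i k = A k j' ∧ not (⁅ i ⁆ k)

  smallThrough : Fin m → Fin n → Bool
  smallThrough i j' = small j' ∧ A i j'

  witness : Fin n → Subset m → Fin m → Fin n → ℕ
  witness j S i j' = 𝟙 (not (A i j)) * 𝟙 (smallThrough i j') * 𝟙 ((S ⊆ᵇ colWithout j' i) ∧ tSet S)

  covered-zeros≤witnesses : ∀ j S →
    𝟙 (tSubsetOf S j) * ones (coveredOff S j) ≤ sumFin (λ i → sumFin (witness j S i))
  covered-zeros≤witnesses j S with tSubsetOf S j in e
  ... | false = z≤n
  ... | true  = ≤-trans (≤-reflexive (trans (+-identityʳ _) (ones≡sumFin (coveredOff S j)))) (sumFin-mono per-row)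
    where
    per-row : ∀ i → 𝟙 (coveredOff S j i) ≤ sumFin (witness j S i)
    per-row i with A i j in Aᵢ
    ... | true  = z≤n
    ... | false = ≤-trans (𝟙-any≤ones (λ j' → smallAbove S j' ∧ A i j'))
                   (≤-trans (≤-reflexive (ones≡sumFin (λ j' → smallAbove S j' ∧ A i j'))) (sumFin-mono per-column))
      where
      i∉S : S i ≡ false
      i∉S with S i in Sᵢ
      ... | false = refl
      ... | true  = ⊥-elim (false≢true (trans (sym Aᵢ) (⊆col e i Sᵢ)))
      S⊆colWithout : ∀ {j'} → smallAbove S j' ≡ true → S ⊆ colWithout j' i
      S⊆colWithout {j'} above k Sₖ = ∧-true (⊆ᵇ-sound {S = S} {col j'} (∧-trueʳ {small j'} above) k Sₖ) k≢i
        where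
        k≢i : not (⁅ i ⁆ k) ≡ true
        k≢i with ⁅ i ⁆ k in k∈
        ... | false = refl
        ... | true  = ⊥-elim (false≢true (trans (sym i∉S) (subst (λ x → S x ≡ true) (∈⁅⁆⇒≡ k∈) Sₖ)))
      per-column : ∀ j' → 𝟙 (smallAbove S j' ∧ A i j') ≤ 1 * 𝟙 (smallThrough i j') * 𝟙 ((S ⊆ᵇ colWithout j' i) ∧ tSet S)
      per-column j' with smallAbove S j' ∧ A i j' in e'
      ... | false = z≤n
      ... | true  rewrite ∧-trueˡ {small j'} (∧-trueˡ {smallAbove S j'} e')
                        | ∧-trueʳ {smallAbove S j'} e'
                        | ⊆ᵇ-complete {S = S} {colWithout j' i} (S⊆colWithout (∧-trueˡ {smallAbove S j'} e'))
                        | ∧-trueʳ {S ⊆ᵇ col j} e = s≤s z≤n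

  witnesses≡ : ∀ j → sumSub (λ S → sumFin (λ i → sumFin (witness j S i)))
    ≡ sumFin (λ i → sumFin (λ j' → 𝟙 (not (A i j)) * 𝟙 (smallThrough i j') * binom (ones (colWithout j' i)) t))
  witnesses≡ j =
    trans (sumSub-sumFin-comm (λ S i → sumFin (witness j S i)))
          (sumFin-cong (λ i → trans (sumSub-sumFin-comm (λ S j' → witness j S i j'))
            (sumFin-cong (λ j' → trans (sumSub-*ˡ {m} (𝟙 (not (A i j)) * 𝟙 (smallThrough i j')) _)
                                       (cong (𝟙 (not (A i j)) * 𝟙 (smallThrough i j') *_)
                                             (countSubsetsOf (colWithout j' i) t))))))

  binom-colWithout≤1 : ∀ i j' → 𝟙 (smallThrough i j') * binom (ones (colWithout j' i)) t ≤ 𝟙 (smallThrough i j')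
  binom-colWithout≤1 i j' with small j' in sm | A i j' in Aᵢ
  ... | true  | true  = ≤-trans (+-monoˡ-≤ 0 (binom≤1 (+-cancelʳ-≤ 1 _ t
                          (subst (_≤ t + 1) (trans (ones-remove {W = col j'} {i} Aᵢ) (+-comm 1 _))
                                 (subst (s j' ≤_) (+-comm 1 t) (small⇒s≤ sm)))))) ≤-refl
  ... | true  | false = z≤n
  ... | false | _     = z≤n

  #smallThrough : Fin m → ℕ
  #smallThrough i = sumFin (λ j' → 𝟙 (smallThrough i j'))

  overcount≤smallThrough : ∀ j → overcount j ≤ sumFin (λ i → 𝟙 (not (A i j)) * #smallThrough i)
  overcount≤smallThrough j = begin
      overcount j
    ≤⟨ sumSub-mono {m} (covered-zeros≤witnesses j) ⟩
      sumSub (λ S → sumFin (λ i → sumFin (witness j S i)))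
    ≡⟨ witnesses≡ j ⟩
      sumFin (λ i → sumFin (λ j' → 𝟙 (not (A i j)) * 𝟙 (smallThrough i j') * binom (ones (colWithout j' i)) t))
    ≤⟨ sumFin-mono (λ i → sumFin-mono (λ j' → drop-binom i j')) ⟩
      sumFin (λ i → sumFin (λ j' → 𝟙 (not (A i j)) * 𝟙 (smallThrough i j')))
    ≡⟨ sumFin-cong (λ i → sumFin-*ˡ {n} (𝟙 (not (A i j))) _) ⟩
      sumFin (λ i → 𝟙 (not (A i j)) * #smallThrough i)
    ∎
    where
    open ≤-Reasoning
    drop-binom : ∀ i j' → 𝟙 (not (A i j)) * 𝟙 (smallThrough i j') * binom (ones (colWithout j' i)) t
                                   ≤ 𝟙 (not (A i j)) * 𝟙 (smallThrough i j')
    drop-binom i j' = ≤-trans (≤-reflexive (*-assoc (𝟙 (not (A i j))) _ _))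
                                        (*-monoʳ-≤ (𝟙 (not (A i j))) (binom-colWithout≤1 i j'))

  module _ (1≤t : 1 ≤ t) where

    smallThrough≤ : ∀ i j' → 𝟙 (smallThrough i j') ≤ 𝟙 (small j') * countBetween ⁅ i ⁆ (col j') t
    smallThrough≤ i j' with small j' in sm | A i j' in Aᵢ
    ... | true  | true  = ≤-trans (binom-pos t∸1≤) (≤-reflexive (sym (trans (+-identityʳ _) count)))
      where
      count : countBetween ⁅ i ⁆ (col j') t ≡ binom (ones (colWithout j' i)) (t ∸ 1)
      count = trans (cong (countBetween ⁅ i ⁆ (col j')) (sym (ones-⁅⁆+[k∸1] i 1≤t)))
                    (countBetween-binom ⁅ i ⁆ (col j')
                      (⊆ᵇ-complete {S = ⁅ i ⁆} {col j'} (λ k k∈ → subst (λ x → A x j' ≡ true) (sym (∈⁅⁆⇒≡ k∈)) Aᵢ)) (t ∸ 1))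
      t∸1≤ : t ∸ 1 ≤ ones (colWithout j' i)
      t∸1≤ = subst (t ∸ 1 ≤_) (cong pred (ones-remove {W = col j'} {i} Aᵢ)) (∸-monoˡ-≤ 1 (t≤s j'))
    ... | true  | false = z≤n
    ... | false | _     = z≤n

    #smallThrough≤ : ∀ i → #smallThrough i ≤ suc λ' * binom (m ∸ 1) (t ∸ 1)
    #smallThrough≤ i = begin
        sumFin (λ j' → 𝟙 (smallThrough i j'))
      ≤⟨ sumFin-mono (smallThrough≤ i) ⟩
        sumFin (λ j' → 𝟙 (small j') * countBetween ⁅ i ⁆ (col j') t)
      ≡⟨ sumFin-cong (λ j' → sym (sumSub-*ˡ {m} (𝟙 (small j')) _)) ⟩
        sumFin (λ j' → sumSub (λ S → 𝟙 (small j') * 𝟙 ((⁅ i ⁆ ⊆ᵇ S) ∧ (S ⊆ᵇ col j') ∧ tSet S)))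
      ≡⟨ sym (sumSub-sumFin-comm (λ S j' → 𝟙 (small j') * 𝟙 ((⁅ i ⁆ ⊆ᵇ S) ∧ (S ⊆ᵇ col j') ∧ tSet S))) ⟩
        sumSub (λ S → sumFin (λ j' → 𝟙 (small j') * 𝟙 ((⁅ i ⁆ ⊆ᵇ S) ∧ (S ⊆ᵇ col j') ∧ tSet S)))
      ≡⟨ sumSub-cong {m} (λ S → sumFin-cong (λ j' → 𝟙-shuffle (small j') (⁅ i ⁆ ⊆ᵇ S) (S ⊆ᵇ col j') (tSet S))) ⟩
        sumSub (λ S → sumFin (λ j' → 𝟙 ((⁅ i ⁆ ⊆ᵇ S) ∧ tSet S) * 𝟙 (smallAbove S j')))
      ≡⟨ sumSub-cong {m} (λ S → trans (sumFin-*ˡ {n} (𝟙 ((⁅ i ⁆ ⊆ᵇ S) ∧ tSet S)) _)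
                                      (cong (𝟙 ((⁅ i ⁆ ⊆ᵇ S) ∧ tSet S) *_) (sym (ones≡sumFin (smallAbove S))))) ⟩
        sumSub (λ S → 𝟙 ((⁅ i ⁆ ⊆ᵇ S) ∧ tSet S) * #smallAbove S)
      ≤⟨ sumSub-mono {m} at-most-λ'+1 ⟩
        sumSub (λ S → suc λ' * 𝟙 ((⁅ i ⁆ ⊆ᵇ S) ∧ tSet S))
      ≡⟨ sumSub-*ˡ {m} (suc λ') _ ⟩
        suc λ' * sumSub (λ S → 𝟙 ((⁅ i ⁆ ⊆ᵇ S) ∧ tSet S))
      ≡⟨ cong (suc λ' *_) (countSupersetsOf⁅⁆ i 1≤t) ⟩
        suc λ' * binom (m ∸ 1) (t ∸ 1)
      ∎
      where
      open ≤-Reasoning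
      at-most-λ'+1 : ∀ S → 𝟙 ((⁅ i ⁆ ⊆ᵇ S) ∧ tSet S) * #smallAbove S ≤ suc λ' * 𝟙 ((⁅ i ⁆ ⊆ᵇ S) ∧ tSet S)
      at-most-λ'+1 S with (⁅ i ⁆ ⊆ᵇ S) ∧ tSet S in e
      ... | false = ≤-reflexive (sym (*-zeroʳ (suc λ')))
      ... | true  = ≤-trans (≤-reflexive (+-identityʳ _))
                      (≤-trans (#smallAbove≤ (≡ᵇ-true⇒≡ (ones S) t (∧-trueʳ {⁅ i ⁆ ⊆ᵇ S} e)))
                               (≤-reflexive (sym (*-identityʳ (suc λ')))))

    overcount≤ : ∀ j → overcount j ≤ zeros j * (suc λ' * binom (m ∸ 1) (t ∸ 1))
    overcount≤ j = begin
        overcount j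
      ≤⟨ overcount≤smallThrough j ⟩
        sumFin (λ i → 𝟙 (not (A i j)) * #smallThrough i)
      ≤⟨ sumFin-mono (λ i → *-monoʳ-≤ (𝟙 (not (A i j))) (#smallThrough≤ i)) ⟩
        sumFin (λ i → 𝟙 (not (A i j)) * K)
      ≡⟨ sumFin-cong (λ i → *-comm (𝟙 (not (A i j))) K) ⟩
        sumFin (λ i → K * 𝟙 (not (A i j)))
      ≡⟨ sumFin-*ˡ K (λ i → 𝟙 (not (A i j))) ⟩
        K * sumFin (λ i → 𝟙 (not (A i j)))
      ≡⟨ trans (cong (K *_) (sym (ones≡sumFin (λ i → not (A i j))))) (*-comm K (zeros j)) ⟩
        zeros j * K
      ∎
      where
      open ≤-Reasoning
      K = suc λ' * binom (m ∸ 1) (t ∸ 1)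

^-distribʳ-* : ∀ a b k → (a * b) ^ k ≡ a ^ k * b ^ k
^-distribʳ-* a b zero    = refl
^-distribʳ-* a b (suc k) = trans (cong (a * b *_) (^-distribʳ-* a b k))
  (solve 4 (λ A B P Q → A :* B :* (P :* Q) := A :* P :* (B :* Q)) refl a b (a ^ k) (b ^ k))

binom-lower : ∀ k x → suc x ^ k ≤ k ! * binom (x + k) k
binom-lower zero    x = ≤-reflexive (sym (trans (+-identityʳ _) (binom-n-0 (x + 0))))
binom-lower (suc k) x = begin
    suc x * suc x ^ k                          ≤⟨ *-monoʳ-≤ (suc x) (binom-lower k x) ⟩
    suc x * (k ! * binom (x + k) k)            ≤⟨ *-monoˡ-≤ _ (s≤s (m≤m+n x k)) ⟩
    suc (x + k) * (k ! * binom (x + k) k)      ≡⟨ solve 3 (λ X F B → X :* (F :* B) := F :* (X :* B)) refl (suc (x + k)) (k !) _ ⟩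
    k ! * (suc (x + k) * binom (x + k) k)      ≡⟨ cong (k ! *_) (sym (binom-absorb (x + k) k)) ⟩
    k ! * (suc k * binom (suc (x + k)) (suc k)) ≡⟨ solve 3 (λ F K B → F :* (K :* B) := K :* F :* B) refl (k !) (suc k) _ ⟩
    suc k ! * binom (suc (x + k)) (suc k)      ≡⟨ cong (λ a → suc k ! * binom a (suc k)) (sym (+-suc x k)) ⟩
    suc k ! * binom (x + suc k) (suc k)        ∎
  where open ≤-Reasoning

binom-upper : ∀ k a → k ! * binom a k ≤ a ^ k
binom-upper zero    a       = ≤-reflexive (trans (+-identityʳ _) (binom-n-0 a))
binom-upper (suc k) zero    = ≤-reflexive (*-zeroʳ (suc k !))
binom-upper (suc k) (suc a) = begin
    suc k * k ! * binom (suc a) (suc k) ≡⟨ solve 3 (λ K F B → K :* F :* B := F :* (K :* B)) refl (suc k) (k !) _ ⟩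
    k ! * (suc k * binom (suc a) (suc k)) ≡⟨ cong (k ! *_) (binom-absorb a k) ⟩
    k ! * (suc a * binom a k)           ≡⟨ solve 3 (λ F A B → F :* (A :* B) := A :* (F :* B)) refl (k !) (suc a) _ ⟩
    suc a * (k ! * binom a k)           ≤⟨ *-monoʳ-≤ (suc a) (binom-upper k a) ⟩
    suc a * a ^ k                       ≤⟨ *-monoʳ-≤ (suc a) (^-monoˡ-≤ k (n≤1+n a)) ⟩
    suc a * suc a ^ k                   ∎
  where open ≤-Reasoning

binom-+-≤ : ∀ a d k → binom (a + d) (suc k) ≤ binom a (suc k) + d * binom (a + d) k
binom-+-≤ a zero    k rewrite +-identityʳ a = m≤m+n _ _
binom-+-≤ a (suc d) k rewrite +-suc a d = begin
    binom (a + d) k + binom (a + d) (suc k)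
  ≤⟨ +-monoʳ-≤ (binom (a + d) k) (binom-+-≤ a d k) ⟩
    binom (a + d) k + (binom a (suc k) + d * binom (a + d) k)
  ≡⟨ solve 3 (λ X Y D → X :+ (Y :+ D :* X) := Y :+ (X :+ D :* X)) refl (binom (a + d) k) (binom a (suc k)) d ⟩
    binom a (suc k) + suc d * binom (a + d) k
  ≤⟨ +-monoʳ-≤ (binom a (suc k)) (*-monoʳ-≤ (suc d) (binom-monoˡ-≤ k (n≤1+n (a + d)))) ⟩
    binom a (suc k) + suc d * binom (suc (a + d)) k
  ∎
  where open ≤-Reasoning

binom-dominates : ∀ t e c a x → e < t → a ≤ 4 * suc x → c * t ! * 4 ^ e ≤ suc x →
  c * binom a e ≤ binom (x + t) t
binom-dominates t e c a x e<t a≤ c≤ = *-cancelˡ-≤ (t !) {{t !≢0}} (begin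
    t ! * (c * binom a e)             ≤⟨ *-monoʳ-≤ (t !) (*-monoʳ-≤ c (m≤n*m (binom a e) (e !) {{e !≢0}})) ⟩
    t ! * (c * (e ! * binom a e))     ≤⟨ *-monoʳ-≤ (t !) (*-monoʳ-≤ c (binom-upper e a)) ⟩
    t ! * (c * a ^ e)                 ≤⟨ *-monoʳ-≤ (t !) (*-monoʳ-≤ c (^-monoˡ-≤ e a≤)) ⟩
    t ! * (c * (4 * suc x) ^ e)       ≡⟨ cong (λ q → t ! * (c * q)) (^-distribʳ-* 4 (suc x) e) ⟩
    t ! * (c * (4 ^ e * suc x ^ e))
      ≡⟨ solve 4 (λ T C F Y → T :* (C :* (F :* Y)) := C :* T :* F :* Y) refl (t !) c (4 ^ e) (suc x ^ e) ⟩
    c * t ! * 4 ^ e * suc x ^ e       ≤⟨ *-monoˡ-≤ (suc x ^ e) c≤ ⟩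
    suc x ^ suc e                     ≤⟨ ^-monoʳ-≤ (suc x) e<t ⟩
    suc x ^ t                         ≤⟨ binom-lower t x ⟩
    t ! * binom (x + t) t             ∎)
  where open ≤-Reasoning

binom≤5^*binom : ∀ l a y → a ≤ 5 * suc y → binom a l ≤ 5 ^ l * binom (y + l) l
binom≤5^*binom l a y a≤ = *-cancelˡ-≤ (l !) {{l !≢0}} (begin
    l ! * binom a l                  ≤⟨ binom-upper l a ⟩
    a ^ l                            ≤⟨ ^-monoˡ-≤ l a≤ ⟩
    (5 * suc y) ^ l                  ≡⟨ ^-distribʳ-* 5 (suc y) l ⟩
    5 ^ l * suc y ^ l                ≤⟨ *-monoʳ-≤ (5 ^ l) (binom-lower l y) ⟩
    5 ^ l * (l ! * binom (y + l) l)  ≡⟨ solve 3 (λ F L Q → F :* (L :* Q) := L :* (F :* Q)) refl (5 ^ l) (l !) _ ⟩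
    l ! * (5 ^ l * binom (y + l) l)  ∎)
  where open ≤-Reasoning

n≤k*binom[n,k] : ∀ {n k} → 1 ≤ k → k ≤ n → n ≤ k * binom n k
n≤k*binom[n,k] {suc n} {suc k} _ (s≤s k≤n) = begin
  suc n                         ≤⟨ m≤m*n (suc n) (binom n k) {{>-nonZero (binom-pos k≤n)}} ⟩
  suc n * binom n k             ≡⟨ sym (binom-absorb n k) ⟩
  suc k * binom (suc n) (suc k) ∎
  where open ≤-Reasoning

1+n≤binom[2+n,n] : ∀ n → suc n ≤ binom (suc (suc n)) n
1+n≤binom[2+n,n] zero    = ≤-refl
1+n≤binom[2+n,n] (suc n) =
  ≤-trans (≤-reflexive (sym (binom-[1+n]-n (suc n)))) (m≤n+m _ (binom (suc (suc n)) n))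

3[1+n]≤2*binom[2+n,n] : ∀ {n} → 1 ≤ n → 3 * suc n ≤ 2 * binom (suc (suc n)) n
3[1+n]≤2*binom[2+n,n] {suc n} _ = begin
    3 * suc (suc n)                       ≤⟨ m≤m+n (3 * suc (suc n)) n ⟩
    3 * suc (suc n) + n
      ≡⟨ solve 1 (λ N → con 3 :* (con 2 :+ N) :+ N := con 2 :* ((con 1 :+ N) :+ (con 2 :+ N))) refl n ⟩
    2 * (suc n + suc (suc n))
      ≤⟨ *-monoʳ-≤ 2 (+-mono-≤ (1+n≤binom[2+n,n] n) (≤-reflexive (sym (binom-[1+n]-n (suc n))))) ⟩
    2 * binom (suc (suc (suc n))) (suc n) ∎
  where open ≤-Reasoning

2*binom[x+l+d]≤3*binom[x+l] : ∀ l x d → l + d ≤ x → d * l * 2 ^ l ≤ x →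
  2 * binom (x + l + d) l ≤ 3 * binom (x + l) l
2*binom[x+l+d]≤3*binom[x+l] zero x d _ _
  rewrite binom-n-0 (x + 0 + d) | binom-n-0 (x + 0) = s≤s (s≤s z≤n)
2*binom[x+l+d]≤3*binom[x+l] (suc k) x d l+d≤x d*l*2^l≤x = begin
    2 * binom (a + d) (suc k)                        ≤⟨ *-monoʳ-≤ 2 (binom-+-≤ a d k) ⟩
    2 * (binom a (suc k) + d * binom (a + d) k)
      ≡⟨ solve 3 (λ X D Y → con 2 :* (X :+ D :* Y) := con 2 :* X :+ con 2 :* D :* Y) refl (binom a (suc k)) d _ ⟩
    2 * binom a (suc k) + 2 * d * binom (a + d) k    ≤⟨ +-monoʳ-≤ (2 * binom a (suc k)) correction≤ ⟩
    2 * binom a (suc k) + binom a (suc k)            ≡⟨ solve 1 (λ X → con 2 :* X :+ X := con 3 :* X) refl (binom a (suc k)) ⟩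
    3 * binom a (suc k)                              ∎
  where
  open ≤-Reasoning
  a = x + suc k
  a+d≤ : a + d ≤ 2 * suc x
  a+d≤ = begin
    x + suc k + d   ≡⟨ +-assoc x (suc k) d ⟩
    x + (suc k + d) ≤⟨ +-monoʳ-≤ x l+d≤x ⟩
    x + x           ≤⟨ +-mono-≤ (n≤1+n x) (≤-trans (n≤1+n x) (m≤m+n (suc x) 0)) ⟩
    2 * suc x       ∎
  correction≤ : 2 * d * binom (a + d) k ≤ binom a (suc k)
  correction≤ = *-cancelˡ-≤ (suc k !) {{suc k !≢0}} (begin
    suc k ! * (2 * d * binom (a + d) k)
      ≡⟨ solve 4 (λ K F D Y → K :* F :* (con 2 :* D :* Y) := con 2 :* D :* K :* (F :* Y)) refl (suc k) (k !) d _ ⟩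
    2 * d * suc k * (k ! * binom (a + d) k)  ≤⟨ *-monoʳ-≤ (2 * d * suc k) (binom-upper k (a + d)) ⟩
    2 * d * suc k * (a + d) ^ k              ≤⟨ *-monoʳ-≤ (2 * d * suc k) (^-monoˡ-≤ k a+d≤) ⟩
    2 * d * suc k * (2 * suc x) ^ k          ≡⟨ cong (2 * d * suc k *_) (^-distribʳ-* 2 (suc x) k) ⟩
    2 * d * suc k * (2 ^ k * suc x ^ k)
      ≡⟨ solve 4 (λ D K T Y → con 2 :* D :* K :* (T :* Y) := D :* K :* (con 2 :* T) :* Y) refl d (suc k) (2 ^ k) _ ⟩
    d * suc k * 2 ^ suc k * suc x ^ k        ≤⟨ *-monoˡ-≤ (suc x ^ k) (≤-trans d*l*2^l≤x (n≤1+n x)) ⟩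
    suc x ^ suc k                            ≤⟨ binom-lower (suc k) x ⟩
    suc k ! * binom (x + suc k) (suc k)      ∎)

module WeightBound (t ℓ λ' : ℕ) (1≤t : 1 ≤ t) (ℓ<t : ℓ < t) where

  P : ℕ
  P = suc λ'

  -- Columns with at least K ones satisfy C(s,t) ≥ (t+1)·5^ℓ; C₁ and C₂ let C(s,t) dominate
  -- once s ≥ m/2; for columns with at most K ones, d is the gap between m − t and the lower
  -- bound x₀ + ℓ on z − λ' − 1.
  K : ℕ
  K = t * (t + 1) * 5 ^ ℓ + t + 2

  d : ℕ
  d = K + P ∸ t

  C₁ : ℕ
  C₁ = 2 * (t + 1) * t ! * 4 ^ ℓ

  C₂ : ℕ
  C₂ = 2 * ((ℓ + P) * P) * t ! * 4 ^ (t ∸ 1)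

  threshold : ℕ
  threshold = t + ℓ + (λ' + 2) + (4 * t + (2 * C₁ + 2 * t + (2 * C₂ + 2 * t
              + (10 * (P + ℓ) + (K + P + ℓ + (ℓ + d + d * ℓ * 2 ^ ℓ) + 2 * (ℓ + P))))))

  module _ {m : ℕ} (large-m : threshold ≤ m) where

    room : t + ℓ + (λ' + 2) ≤ m
    room = m+n≤o⇒m≤o (t + ℓ + (λ' + 2)) large-m

    private
      r₁ = m+n≤o⇒n≤o (t + ℓ + (λ' + 2)) large-m
      r₂ = m+n≤o⇒n≤o (4 * t) r₁
      r₃ = m+n≤o⇒n≤o (2 * C₁ + 2 * t) r₂
      r₄ = m+n≤o⇒n≤o (2 * C₂ + 2 * t) r₃
      r₅ = m+n≤o⇒n≤o (10 * (P + ℓ)) r₄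

    4t≤m : 4 * t ≤ m
    4t≤m = m+n≤o⇒m≤o (4 * t) r₁
    C₁≤m : 2 * C₁ + 2 * t ≤ m
    C₁≤m = m+n≤o⇒m≤o (2 * C₁ + 2 * t) r₂
    C₂≤m : 2 * C₂ + 2 * t ≤ m
    C₂≤m = m+n≤o⇒m≤o (2 * C₂ + 2 * t) r₃
    10[P+ℓ]≤m : 10 * (P + ℓ) ≤ m
    10[P+ℓ]≤m = m+n≤o⇒m≤o (10 * (P + ℓ)) r₄
    K+P+ℓ+shift≤m : K + P + ℓ + (ℓ + d + d * ℓ * 2 ^ ℓ) ≤ m
    K+P+ℓ+shift≤m = m+n≤o⇒m≤o (K + P + ℓ + (ℓ + d + d * ℓ * 2 ^ ℓ)) r₅
    2[ℓ+P]≤m : 2 * (ℓ + P) ≤ m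
    2[ℓ+P]≤m = m+n≤o⇒n≤o (K + P + ℓ + (ℓ + d + d * ℓ * 2 ^ ℓ)) r₅

    Q : ℕ
    Q = K + P + ℓ

    x₀ : ℕ
    x₀ = m ∸ Q

    x₀+Q≡m : x₀ + Q ≡ m
    x₀+Q≡m = m∸n+n≡m (m+n≤o⇒m≤o Q K+P+ℓ+shift≤m)
    d+t≡K+P : d + t ≡ K + P
    d+t≡K+P = m∸n+n≡m (≤-trans (≤-trans (m≤n+m t (t * (t + 1) * 5 ^ ℓ)) (m≤m+n _ 2)) (m≤m+n K P))
    m∸t≡x₀+ℓ+d : m ∸ t ≡ x₀ + ℓ + d
    m∸t≡x₀+ℓ+d = trans (cong (_∸ t) (sym (begin-equality
        x₀ + ℓ + d + t    ≡⟨ solve 4 (λ X L D T → X :+ L :+ D :+ T := X :+ ((D :+ T) :+ L)) refl x₀ ℓ d t ⟩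
        x₀ + (d + t + ℓ)  ≡⟨ cong (λ q → x₀ + (q + ℓ)) d+t≡K+P ⟩
        x₀ + Q            ≡⟨ x₀+Q≡m ⟩
        m                ∎)))
      (m+n∸n≡m (x₀ + ℓ + d) t)
      where open ≤-Reasoning
    shift≤x₀ : ℓ + d + d * ℓ * 2 ^ ℓ ≤ x₀
    shift≤x₀ = +-cancelˡ-≤ Q _ x₀ (≤-trans K+P+ℓ+shift≤m (≤-reflexive (trans (sym x₀+Q≡m) (+-comm x₀ Q))))
    ℓ+d≤x₀ : ℓ + d ≤ x₀
    ℓ+d≤x₀ = m+n≤o⇒m≤o (ℓ + d) shift≤x₀
    d*ℓ*2^ℓ≤x₀ : d * ℓ * 2 ^ ℓ ≤ x₀
    d*ℓ*2^ℓ≤x₀ = m+n≤o⇒n≤o (ℓ + d) shift≤x₀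

    module _ {s z W over : ℕ} (s+z≡m : s + z ≡ m) (2+t≤s : suc (suc t) ≤ s)
      (weight≥ : binom s t * binom (z ∸ P) ℓ ≤ W)
      (weight+over≥ : binom s t ≤ W + over)
      (over≤ : over ≤ z * (P * binom (m ∸ 1) (t ∸ 1))) where

      X : ℕ
      X = (t + 1) * binom (m ∸ t) ℓ

      X≤ : X ≤ (t + 1) * binom m ℓ
      X≤ = *-monoʳ-≤ (t + 1) (binom-monoˡ-≤ ℓ (m∸n≤m m t))

      t≤s : t ≤ s
      t≤s = ≤-trans (n≤1+n t) (≤-trans (n≤1+n (suc t)) 2+t≤s)

      2m≡2s+2z : m + m ≡ 2 * s + 2 * z
      2m≡2s+2z = trans (cong₂ _+_ (sym s+z≡m) (sym s+z≡m))
                       (solve 2 (λ S Z → (S :+ Z) :+ (S :+ Z) := con 2 :* S :+ con 2 :* Z) refl s z)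

      module LongColumn (m≤2s : m ≤ 2 * s) where

        x : ℕ
        x = s ∸ t

        x+t≡s : x + t ≡ s
        x+t≡s = m∸n+n≡m t≤s

        m≤4[1+x] : m ≤ 4 * suc x
        m≤4[1+x] = ≤-trans (+-cancelʳ-≤ m m (4 * x) (begin
            m + m             ≡⟨ solve 1 (λ M → M :+ M := con 2 :* M) refl m ⟩
            2 * m             ≤⟨ *-monoʳ-≤ 2 m≤2s ⟩
            2 * (2 * s)       ≡⟨ cong (λ q → 2 * (2 * q)) (sym x+t≡s) ⟩
            2 * (2 * (x + t)) ≡⟨ solve 2 (λ X T → con 2 :* (con 2 :* (X :+ T)) := con 4 :* X :+ con 4 :* T) refl x t ⟩
            4 * x + 4 * t     ≤⟨ +-monoʳ-≤ (4 * x) 4t≤m ⟩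
            4 * x + m         ∎)) (*-monoʳ-≤ 4 (n≤1+n x))
          where open ≤-Reasoning

        ≤1+x : ∀ C → 2 * C + 2 * t ≤ m → C ≤ suc x
        ≤1+x C 2C+2t≤m = ≤-trans (*-cancelˡ-≤ 2 (+-cancelʳ-≤ (2 * t) (2 * C) (2 * x)
          (≤-trans 2C+2t≤m (≤-trans m≤2s (≤-reflexive (trans (cong (2 *_) (sym x+t≡s)) (*-distribˡ-+ 2 x t)))))))
          (n≤1+n x)

        binom-m-ℓ≤ : 2 * (t + 1) * binom m ℓ ≤ binom s t
        binom-m-ℓ≤ = subst (λ q → 2 * (t + 1) * binom m ℓ ≤ binom q t) x+t≡s
          (binom-dominates t ℓ (2 * (t + 1)) m x ℓ<t m≤4[1+x] (≤1+x C₁ C₁≤m))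

        binom-m-1≤ : 2 * ((ℓ + P) * P) * binom (m ∸ 1) (t ∸ 1) ≤ binom s t
        binom-m-1≤ = subst (λ q → 2 * ((ℓ + P) * P) * binom (m ∸ 1) (t ∸ 1) ≤ binom q t) x+t≡s
          (binom-dominates t (t ∸ 1) (2 * ((ℓ + P) * P)) (m ∸ 1) x (∸-monoʳ-< {t} {1} {0} z<s 1≤t)
                           (≤-trans (m∸n≤m m 1) m≤4[1+x]) (≤1+x C₂ C₂≤m))

      few-zeros : z < ℓ + P → X ≤ W
      few-zeros z<ℓ+P = +-cancelʳ-≤ Y X W (≤-trans X+Y≤ (≤-trans weight+over≥ (+-monoʳ-≤ W over≤)))
        where
        Y = z * (P * binom (m ∸ 1) (t ∸ 1))
        m≤2s : m ≤ 2 * s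
        m≤2s = +-cancelʳ-≤ m m (2 * s) (begin
          m + m           ≡⟨ 2m≡2s+2z ⟩
          2 * s + 2 * z   ≤⟨ +-monoʳ-≤ (2 * s) (≤-trans (*-monoʳ-≤ 2 (<⇒≤ z<ℓ+P)) 2[ℓ+P]≤m) ⟩
          2 * s + m       ∎)
          where open ≤-Reasoning
        open LongColumn m≤2s
        X+Y≤ : X + Y ≤ binom s t
        X+Y≤ = *-cancelˡ-≤ 2 (begin
          2 * (X + Y)
            ≤⟨ *-monoʳ-≤ 2 (+-mono-≤ X≤ (*-monoˡ-≤ (P * binom (m ∸ 1) (t ∸ 1)) (<⇒≤ z<ℓ+P))) ⟩
          2 * ((t + 1) * binom m ℓ + (ℓ + P) * (P * binom (m ∸ 1) (t ∸ 1)))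
            ≡⟨ solve 5 (λ T B L Q C → con 2 :* (T :* B :+ L :* (Q :* C)) := con 2 :* T :* B :+ con 2 :* (L :* Q) :* C)
                       refl (t + 1) (binom m ℓ) (ℓ + P) P (binom (m ∸ 1) (t ∸ 1)) ⟩
          2 * (t + 1) * binom m ℓ + 2 * ((ℓ + P) * P) * binom (m ∸ 1) (t ∸ 1)
            ≤⟨ +-mono-≤ binom-m-ℓ≤ binom-m-1≤ ⟩
          binom s t + binom s t
            ≡⟨ solve 1 (λ Q → Q :+ Q := con 2 :* Q) refl (binom s t) ⟩
          2 * binom s t ∎)
          where open ≤-Reasoning

      ℓ≤z∸P : ℓ + P ≤ z → ℓ ≤ z ∸ P
      ℓ≤z∸P ℓ+P≤z = subst (_≤ z ∸ P) (m+n∸n≡m ℓ P) (∸-monoˡ-≤ P ℓ+P≤z)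

      long-column : ℓ + P ≤ z → m ≤ 2 * s → X ≤ W
      long-column ℓ+P≤z m≤2s = begin
          X                               ≤⟨ X≤ ⟩
          (t + 1) * binom m ℓ             ≤⟨ m≤n*m _ 2 ⟩
          2 * ((t + 1) * binom m ℓ)       ≡⟨ sym (*-assoc 2 (t + 1) (binom m ℓ)) ⟩
          2 * (t + 1) * binom m ℓ         ≤⟨ binom-m-ℓ≤ ⟩
          binom s t                       ≤⟨ m≤m*n (binom s t) (binom (z ∸ P) ℓ) {{>-nonZero (binom-pos (ℓ≤z∸P ℓ+P≤z))}} ⟩
          binom s t * binom (z ∸ P) ℓ     ≤⟨ weight≥ ⟩
          W                               ∎
        where
        open ≤-Reasoning
        open LongColumn m≤2s

      medium-column : ℓ + P ≤ z → K ≤ s → 2 * s ≤ m → X ≤ W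
      medium-column ℓ+P≤z K≤s 2s≤m = begin
          X                                    ≤⟨ X≤ ⟩
          (t + 1) * binom m ℓ                  ≤⟨ *-monoʳ-≤ (t + 1) (binom≤5^*binom ℓ m y m≤5[1+y]) ⟩
          (t + 1) * (5 ^ ℓ * binom (y + ℓ) ℓ)  ≡⟨ sym (*-assoc (t + 1) (5 ^ ℓ) _) ⟩
          (t + 1) * 5 ^ ℓ * binom (y + ℓ) ℓ    ≤⟨ *-monoˡ-≤ (binom (y + ℓ) ℓ) [t+1]5^ℓ≤ ⟩
          binom s t * binom (y + ℓ) ℓ          ≡⟨ cong (λ q → binom s t * binom q ℓ) (sym z∸P≡y+ℓ) ⟩
          binom s t * binom (z ∸ P) ℓ          ≤⟨ weight≥ ⟩
          W                                    ∎
        where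
        open ≤-Reasoning
        y = z ∸ (P + ℓ)
        y+P+ℓ≡z : y + (P + ℓ) ≡ z
        y+P+ℓ≡z = m∸n+n≡m (subst (_≤ z) (+-comm ℓ P) ℓ+P≤z)
        z∸P≡y+ℓ : z ∸ P ≡ y + ℓ
        z∸P≡y+ℓ = trans (cong (_∸ P) (trans (sym y+P+ℓ≡z) (solve 3 (λ Y Q L → Y :+ (Q :+ L) := (Y :+ L) :+ Q) refl y P ℓ)))
                        (m+n∸n≡m (y + ℓ) P)
        m≤2z : m ≤ 2 * z
        m≤2z = +-cancelˡ-≤ m m (2 * z) (≤-trans (≤-reflexive 2m≡2s+2z) (+-monoˡ-≤ (2 * z) 2s≤m))
        m≤5[1+y] : m ≤ 5 * suc y
        m≤5[1+y] = *-cancelˡ-≤ 4 (≤-trans (+-cancelʳ-≤ m (4 * m) (10 * y) (begin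
            4 * m + m                  ≡⟨ solve 1 (λ M → con 4 :* M :+ M := con 5 :* M) refl m ⟩
            5 * m                      ≤⟨ *-monoʳ-≤ 5 m≤2z ⟩
            5 * (2 * z)                ≡⟨ cong (λ q → 5 * (2 * q)) (sym y+P+ℓ≡z) ⟩
            5 * (2 * (y + (P + ℓ)))    ≡⟨ solve 2 (λ Y Q → con 5 :* (con 2 :* (Y :+ Q)) := con 10 :* Y :+ con 10 :* Q) refl y (P + ℓ) ⟩
            10 * y + 10 * (P + ℓ)      ≤⟨ +-monoʳ-≤ (10 * y) 10[P+ℓ]≤m ⟩
            10 * y + m                 ∎))
          (≤-trans (m≤m+n (10 * y) (10 * y + 20))
                   (≤-reflexive (solve 1 (λ Y → con 10 :* Y :+ (con 10 :* Y :+ con 20) := con 4 :* (con 5 :* (con 1 :+ Y))) refl y))))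
        [t+1]5^ℓ≤ : (t + 1) * 5 ^ ℓ ≤ binom s t
        [t+1]5^ℓ≤ = *-cancelˡ-≤ t {{>-nonZero 1≤t}} (begin
            t * ((t + 1) * 5 ^ ℓ)  ≡⟨ sym (*-assoc t (t + 1) (5 ^ ℓ)) ⟩
            t * (t + 1) * 5 ^ ℓ    ≤⟨ ≤-trans (m≤m+n (t * (t + 1) * 5 ^ ℓ) t) (m≤m+n _ 2) ⟩
            K                      ≤⟨ K≤s ⟩
            s                      ≤⟨ n≤k*binom[n,k] 1≤t t≤s ⟩
            t * binom s t          ∎)

      short-column : s ≤ K → X ≤ W
      short-column s≤K = *-cancelˡ-≤ 2 (begin
          2 * ((t + 1) * binom (m ∸ t) ℓ)      ≡⟨ cong (λ q → 2 * ((t + 1) * binom q ℓ)) m∸t≡x₀+ℓ+d ⟩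
          2 * ((t + 1) * binom (x₀ + ℓ + d) ℓ)  ≡⟨ solve 2 (λ T Q → con 2 :* (T :* Q) := T :* (con 2 :* Q)) refl (t + 1) _ ⟩
          (t + 1) * (2 * binom (x₀ + ℓ + d) ℓ)  ≤⟨ *-monoʳ-≤ (t + 1) (2*binom[x+l+d]≤3*binom[x+l] ℓ x₀ d ℓ+d≤x₀ d*ℓ*2^ℓ≤x₀) ⟩
          (t + 1) * (3 * binom (x₀ + ℓ) ℓ)      ≡⟨ solve 2 (λ T Q → T :* (con 3 :* Q) := con 3 :* T :* Q) refl (t + 1) _ ⟩
          3 * (t + 1) * binom (x₀ + ℓ) ℓ        ≤⟨ *-mono-≤ 3[t+1]≤ (binom-monoˡ-≤ ℓ x₀+ℓ≤z∸P) ⟩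
          2 * binom s t * binom (z ∸ P) ℓ      ≡⟨ *-assoc 2 (binom s t) _ ⟩
          2 * (binom s t * binom (z ∸ P) ℓ)    ≤⟨ *-monoʳ-≤ 2 weight≥ ⟩
          2 * W                                ∎)
        where
        open ≤-Reasoning
        x₀+ℓ≤z∸P : x₀ + ℓ ≤ z ∸ P
        x₀+ℓ≤z∸P = subst (_≤ z ∸ P) (m+n∸n≡m (x₀ + ℓ) P) (∸-monoˡ-≤ P (+-cancelˡ-≤ K (x₀ + ℓ + P) z (begin
            K + (x₀ + ℓ + P) ≡⟨ solve 4 (λ K' X L Q' → K' :+ (X :+ L :+ Q') := X :+ (K' :+ Q' :+ L)) refl K x₀ ℓ P ⟩
            x₀ + Q           ≡⟨ x₀+Q≡m ⟩
            m               ≡⟨ sym s+z≡m ⟩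
            s + z           ≤⟨ +-monoˡ-≤ z s≤K ⟩
            K + z           ∎)))
        3[t+1]≤ : 3 * (t + 1) ≤ 2 * binom s t
        3[t+1]≤ = ≤-trans (≤-reflexive (cong (3 *_) (+-comm t 1)))
                          (≤-trans (3[1+n]≤2*binom[2+n,n] 1≤t) (*-monoʳ-≤ 2 (binom-monoˡ-≤ t 2+t≤s)))

      weight-bound : X ≤ W
      weight-bound with ℓ + P ≤? z
      ... | no  ℓ+P≰z = few-zeros (≰⇒> ℓ+P≰z)
      ... | yes ℓ+P≤z with s ≤? K
      ...   | yes s≤K = short-column s≤K
      ...   | no  s≰K with 2 * s ≤? m
      ...     | yes 2s≤m = medium-column ℓ+P≤z (<⇒≤ (≰⇒> s≰K)) 2s≤m
      ...     | no  2s≰m = long-column ℓ+P≤z (<⇒≤ (≰⇒> 2s≰m))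

-- The argument does not need the hypothesis 1 ≤ λ'.
lemma9 : (t ℓ λ' : ℕ) → ℓ < t → 1 ≤ λ' →
  ∃ λ M → ∀ m → M ≤ m → ∀ n → (A : Matrix m n) →
    ¬ (copiesOneZero (λ' + 2) t ℓ ≺ A) →
    (∀ j → t ≤ colSum A j × colSum A j ≤ m ∸ ℓ) →
    (∀ j j' → colSum A j ≡ t → colSum A j' ≡ t → SameColumn A j j' → j ≡ j') →
    (t + 1) * n ≤ (t + 1 + λ') * (m C t)
lemma9 t ℓ λ' ℓ<t _ = threshold , λ m large-m n A avoids sizes distinct →
  let open Avoiding A avoids (room large-m) (λ j → proj₁ (sizes j)) distinct in
  bound-from-weights λ j large-j →
    weight-bound large-m (ones-complement (col j)) (large⇒2+t≤s large-j) (weight≥ j)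
                 (binom≤weight+overcount j (ℓ≤zeros (proj₂ (sizes j)))) (overcount≤ 1≤t j)
  where
  1≤t : 1 ≤ t
  1≤t = ≤-trans (s≤s z≤n) ℓ<t
  open WeightBound t ℓ λ' 1≤t ℓ<t
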